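{- Let $p,q$ be nonzero integers with $p+q$ odd and $\gcd(p,q)=1$, and suppose $2p(p^2+3q^2)=\theta^3$ for some nonzero integer $\theta$. Then $q$ is odd and $9\mid p$. In particular, $3\mid\theta$ and $3\nmid q$. -}

-- With x = p - q and y = p + q the equation reads x³ + y³ = θ³: this is the second case of
-- Euler's proof of Fermat's Last Theorem for exponent 3. If q were even, θ³ would be twice an
-- odd number. If 3 ∤ p, then 2p and p² + 3q² are coprime, so 2p = r³, and in the Euclidean
-- domain ℤ[ω] the element p + q√-3 is a cube (u + v√-3)³. Then 2p = 2u(u - 3v)(u + 3v) with
-- pairwise coprime factors, each a cube: a³, b³, c³ with b³ + c³ = a³, a smaller solution of
-- the same kind with 3 ∤ (b + c)/2. Infinite descent on |θ| rules this case out, so p = 3k;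
-- then 3 ∣ θ, 3 ∤ q by coprimality, and 3t³ = 2k(3k² + q²) forces 3 ∣ k.
module Submission where

open import Algebra.Bundles using (CommutativeRing)
open import Algebra.Structures using (IsCommutativeRing)
open import Data.Nat as ℕ using (ℕ; zero; suc; s≤s; z≤n)
import Data.Nat.Properties as ℕ
open import Data.Product using (∃; ∃₂; _×_; _,_; proj₁; proj₂)
open import Relation.Binary.PropositionalEquality
open import Relation.Nullary using (¬_; Dec; yes; no)

open ≡-Reasoning

-- Euclidean domains

record EuclideanDomain : Set₁ where
  infixl 6 _+_
  infixl 7 _*_
  infix  8 -_
  field
    Carrier           : Set
    _+_ _*_           : Carrier → Carrier → Carrier
    -_                : Carrier → Carrier
    0# 1#             : Carrier
    isCommutativeRing : IsCommutativeRing _≡_ _+_ _*_ -_ 0# 1#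
    _≟0               : ∀ x → Dec (x ≡ 0#)
    *-cancelˡ-≡       : ∀ x {y z} → x ≢ 0# → x * y ≡ x * z → y ≡ z
    size              : Carrier → ℕ
    divMod            : ∀ a b → b ≢ 0# →
                        ∃₂ λ q r → a ≡ q * b + r × size r ℕ.< size b

module EuclideanDomainProperties (D : EuclideanDomain) where

  open EuclideanDomain D
  private
    commutativeRing : CommutativeRing _ _
    commutativeRing = record { isCommutativeRing = isCommutativeRing }
  open CommutativeRing commutativeRing
    using (_-_; zeroˡ; zeroʳ; *-identityˡ; *-identityʳ; +-identityʳ; +-comm; *-comm; *-assoc; +-group; commutativeSemiring)
  open import Algebra.Properties.Group +-group using (//-rightDividesˡ)
  -- Over an abstract carrier only the ℕ-coefficient solver applies, and it knows no subtraction.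
  open import Algebra.Solver.Ring.NaturalCoefficients.Default commutativeSemiring

  infix 4 _∣_
  _∣_ : Carrier → Carrier → Set
  d ∣ x = ∃ λ k → x ≡ k * d

  ∣-refl : ∀ {x} → x ∣ x
  ∣-refl {x} = 1# , sym (*-identityˡ x)

  Unit : Carrier → Set
  Unit u = ∃ λ v → u * v ≡ 1#

  Coprime : Carrier → Carrier → Set
  Coprime x y = ∃₂ λ s t → s * x + t * y ≡ 1#

  record GCD (a b : Carrier) : Set where
    field
      gcd     : Carrier
      gcd∣a   : gcd ∣ a
      gcd∣b   : gcd ∣ b
      s t     : Carrier
      bézout  : gcd ≡ s * a + t * b

  gcd-with-bézout : ∀ a b → GCD a b
  gcd-with-bézout a b = go (suc (size b)) a b ℕ.≤-refl
    where
    go : ∀ n a b → size b ℕ.< n → GCD a b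
    go (suc n) a b sb<n with b ≟0
    ... | yes refl = record
      { gcd = a ; gcd∣a = ∣-refl ; gcd∣b = 0# , sym (zeroˡ a) ; s = 1# ; t = 0#
      ; bézout = sym (trans (cong₂ _+_ (*-identityˡ a) (zeroʳ 0#)) (+-identityʳ a)) }
    ... | no b≢0 with divMod a b b≢0
    ... | q , r , a≡qb+r , sr<sb with go n b r (ℕ.<-≤-trans sr<sb (ℕ.≤-pred sb<n))
    ... | record { gcd = g ; gcd∣a = k , b≡kg ; gcd∣b = l , r≡lg ; s = s ; t = t ; bézout = g≡sb+tr } =
      record
      { gcd = g
      ; gcd∣a = k * q + l , (begin
          a                   ≡⟨ a≡qb+r ⟩
          q * b + r           ≡⟨ cong₂ (λ b r → q * b + r) b≡kg r≡lg ⟩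
          q * (k * g) + l * g ≡⟨ solve 4 (λ q k l g → q :* (k :* g) :+ l :* g := (k :* q :+ l) :* g) refl q k l g ⟩
          (k * q + l) * g     ∎)
      ; gcd∣b = k , b≡kg
      ; s = t
      ; t = s - t * q
      ; bézout = begin
          g                                 ≡⟨ g≡sb+tr ⟩
          s * b + t * r                     ≡⟨ cong (λ s → s * b + t * r) (sym (//-rightDividesˡ (t * q) s)) ⟩
          (s - t * q + t * q) * b + t * r
            ≡⟨ solve 5 (λ u t q b r → (u :+ t :* q) :* b :+ t :* r := t :* (q :* b :+ r) :+ u :* b) refl (s - t * q) t q b r ⟩
          t * (q * b + r) + (s - t * q) * b ≡⟨ cong (λ a → t * a + (s - t * q) * b) (sym a≡qb+r) ⟩
          t * a + (s - t * q) * b           ∎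
      }

  coprime-sym : ∀ {x y} → Coprime x y → Coprime y x
  coprime-sym {x} {y} (s , t , sx+ty≡1) = t , s , trans (+-comm (t * y) (s * x)) sx+ty≡1

  coprime-*ʳ : ∀ {a b c} → Coprime a b → Coprime a c → Coprime a (b * c)
  coprime-*ʳ {a} {b} {c} (s , t , sa+tb≡1) (s′ , t′ , s′a+t′c≡1) =
    s * s′ * a + s * t′ * c + t * b * s′ , t * t′ , (begin
      (s * s′ * a + s * t′ * c + t * b * s′) * a + t * t′ * (b * c)
        ≡⟨ solve 7 (λ s t s′ t′ a b c → (s :* s′ :* a :+ s :* t′ :* c :+ t :* b :* s′) :* a :+ t :* t′ :* (b :* c)
                                         := (s :* a :+ t :* b) :* (s′ :* a :+ t′ :* c)) refl s t s′ t′ a b c ⟩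
      (s * a + t * b) * (s′ * a + t′ * c) ≡⟨ cong₂ _*_ sa+tb≡1 s′a+t′c≡1 ⟩
      1# * 1#                             ≡⟨ *-identityˡ 1# ⟩
      1#                                  ∎)

  coprime-*ˡ : ∀ {a b c} → Coprime a c → Coprime b c → Coprime (a * b) c
  coprime-*ˡ ac bc = coprime-sym (coprime-*ʳ (coprime-sym ac) (coprime-sym bc))

  coprime-+-multiple : ∀ {a b} k → Coprime a b → Coprime a (b + k * a)
  coprime-+-multiple {a} {b} k (s , t , sa+tb≡1) = s - t * k , t , (begin
    (s - t * k) * a + t * (b + k * a)
      ≡⟨ solve 5 (λ u t k a b → u :* a :+ t :* (b :+ k :* a) := (u :+ t :* k) :* a :+ t :* b) refl (s - t * k) t k a b ⟩
    (s - t * k + t * k) * a + t * b ≡⟨ cong (λ s → s * a + t * b) (//-rightDividesˡ (t * k) s) ⟩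
    s * a + t * b                   ≡⟨ sa+tb≡1 ⟩
    1#                              ∎)

  coprime-divisors : ∀ {d e x y} → d ∣ x → e ∣ y → Coprime x y → Coprime d e
  coprime-divisors {d} {e} (k , refl) (l , refl) (s , t , e′) =
    s * k , t * l ,
    trans (solve 6 (λ s k d t l e → s :* k :* d :+ t :* l :* e := s :* (k :* d) :+ t :* (l :* e)) refl s k d t l e) e′

  common-divisor-unit : ∀ {d x y} → d ∣ x → d ∣ y → Coprime x y → Unit d
  common-divisor-unit {d} (k , refl) (l , refl) (s , t , e) =
    s * k + t * l ,
    trans (solve 5 (λ d s k t l → d :* (s :* k :+ t :* l) := s :* (k :* d) :+ t :* (l :* d)) refl d s k t l) e

  cube-of-combination : ∀ {g x y z} s t → g ≡ s * x + t * z → x * y ≡ z * z * z →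
                        g * g * g ≡ x * (s * (g * g + g * (t * z) + t * z * (t * z)) + t * t * t * y)
  cube-of-combination {g} {x} {y} {z} s t g≡sx+tz xy≡z³ = begin
    g * g * g ≡⟨ cong (λ g → g * g * g) g≡sx+tz ⟩
    h * h * h ≡⟨ solve 4 (λ s t x z → let h = s :* x :+ t :* z in
                   h :* h :* h := x :* (s :* (h :* h :+ h :* (t :* z) :+ t :* z :* (t :* z))) :+ t :* t :* t :* (z :* z :* z))
                 refl s t x z ⟩
    x * (s * (h * h + h * (t * z) + t * z * (t * z))) + t * t * t * (z * z * z)
      ≡⟨ cong₂ (λ h c → x * (s * (h * h + h * (t * z) + t * z * (t * z))) + t * t * t * c) (sym g≡sx+tz) (sym xy≡z³) ⟩
    x * n + t * t * t * (x * y)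
      ≡⟨ solve 4 (λ x n t y → x :* n :+ t :* t :* t :* (x :* y) := x :* (n :+ t :* t :* t :* y)) refl x n t y ⟩
    x * (n + t * t * t * y) ∎
    where
    h = s * x + t * z
    n = s * (g * g + g * (t * z) + t * z * (t * z))

  -- With g = gcd(x, z) one finds g³ = x m, where m divides both x² and y, so m is a unit.
  coprime-product-unit-cube : ∀ {x y z} → x ≢ 0# → Coprime x y → x * y ≡ z * z * z →
                              ∃₂ λ u w → Unit u × x ≡ u * (w * w * w)
  coprime-product-unit-cube {x} {y} {z} x≢0 coprime xy≡z³ = u , g , (m , trans (*-comm u m) mu≡1) , x≡ug³
    where
    open GCD (gcd-with-bézout x z) renaming (gcd to g)
    a = proj₁ gcd∣a
    b = proj₁ gcd∣b
    x≡ag = proj₂ gcd∣a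
    z≡bg = proj₂ gcd∣b
    m = s * (g * g + g * (t * z) + t * z * (t * z)) + t * t * t * y
    g³≡xm : g * g * g ≡ x * m
    g³≡xm = cube-of-combination s t bézout xy≡z³
    g≢0 : g ≢ 0#
    g≢0 g≡0 = x≢0 (trans x≡ag (trans (cong (a *_) g≡0) (zeroʳ a)))
    g²≡am : g * g ≡ a * m
    g²≡am = *-cancelˡ-≡ g g≢0 (begin
      g * (g * g) ≡⟨ sym (*-assoc g g g) ⟩
      g * g * g   ≡⟨ g³≡xm ⟩
      x * m       ≡⟨ cong (_* m) x≡ag ⟩
      a * g * m   ≡⟨ solve 3 (λ a g m → a :* g :* m := g :* (a :* m)) refl a g m ⟩
      g * (a * m) ∎)
    y≡b³m : y ≡ b * b * b * m
    y≡b³m = *-cancelˡ-≡ x x≢0 (begin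
      x * y                     ≡⟨ xy≡z³ ⟩
      z * z * z                 ≡⟨ cong (λ z → z * z * z) z≡bg ⟩
      b * g * (b * g) * (b * g) ≡⟨ solve 2 (λ b g → b :* g :* (b :* g) :* (b :* g) := b :* b :* b :* (g :* g :* g)) refl b g ⟩
      b * b * b * (g * g * g)   ≡⟨ cong (b * b * b *_) g³≡xm ⟩
      b * b * b * (x * m)       ≡⟨ solve 3 (λ c x m → c :* (x :* m) := x :* (c :* m)) refl (b * b * b) x m ⟩
      x * (b * b * b * m)       ∎)
    m∣x² : m ∣ x * x
    m∣x² = a * a * a , (begin
      x * x             ≡⟨ cong (λ x → x * x) x≡ag ⟩
      a * g * (a * g)   ≡⟨ solve 2 (λ a g → a :* g :* (a :* g) := a :* a :* (g :* g)) refl a g ⟩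
      a * a * (g * g)   ≡⟨ cong (a * a *_) g²≡am ⟩
      a * a * (a * m)   ≡⟨ solve 2 (λ a m → a :* a :* (a :* m) := a :* a :* a :* m) refl a m ⟩
      a * a * a * m     ∎)
    m-unit : Unit m
    m-unit = common-divisor-unit m∣x² (b * b * b , y≡b³m) (coprime-*ˡ coprime coprime)
    u = proj₁ m-unit
    mu≡1 = proj₂ m-unit
    x≡ug³ : x ≡ u * (g * g * g)
    x≡ug³ = begin
      x             ≡⟨ sym (*-identityʳ x) ⟩
      x * 1#        ≡⟨ cong (x *_) (sym mu≡1) ⟩
      x * (m * u)   ≡⟨ solve 3 (λ x m u → x :* (m :* u) := u :* (x :* m)) refl x m u ⟩
      u * (x * m)   ≡⟨ cong (u *_) (sym g³≡xm) ⟩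
      u * (g * g * g) ∎

-- Integers

open import Data.Bool using (Bool; true; false; _∧_; _xor_)
open import Data.Empty using (⊥; ⊥-elim)
open import Data.Integer
  using (ℤ; +_; -[1+_]; +0; _+_; _*_; -_; _-_; _^_; ∣_∣; _/_; _%_; ≢-nonZero; 0ℤ; 1ℤ; -1ℤ; _≟_)
open import Data.Integer.DivMod using (a≡a%n+[a/n]*n; n%d<d)
open import Data.Integer.Divisibility using (_∣_)
import Data.Integer.Divisibility.Signed as Signed
open import Data.Integer.GCD using (gcd; gcd-greatest)
import Data.Integer.Properties as ℤ
open import Data.Integer.Tactic.RingSolver using (solve-∀; solve)
open import Data.List using (_∷_; [])
open import Data.Maybe using (just; nothing)
import Data.Nat.Divisibility as ℕ using (∣1⇒≡1)
open import Data.Nat.Induction using (<-wellFounded)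
open import Data.Sum using (_⊎_; inj₁; inj₂; [_,_]′)
open import Induction.WellFounded using (Acc; acc)
import Tactic.RingSolver as RingSolver
open import Tactic.RingSolver.Core.AlmostCommutativeRing using (AlmostCommutativeRing; fromCommutativeRing)

ℤ-euclideanDomain : EuclideanDomain
ℤ-euclideanDomain = record
  { isCommutativeRing = ℤ.+-*-isCommutativeRing
  ; _≟0 = ℤ._≟ 0ℤ
  ; *-cancelˡ-≡ = λ x {y} {z} x≢0 → ℤ.*-cancelˡ-≡ x y z {{≢-nonZero x≢0}}
  ; size = ∣_∣
  ; divMod = λ a b b≢0 → let instance _ = ≢-nonZero b≢0 in
      a / b , + (a % b) , trans (a≡a%n+[a/n]*n a b) (ℤ.+-comm (+ (a % b)) (a / b * b)) , n%d<d a b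
  }

-- _∣′_ is divisibility in the sense of the Euclidean domain; _∣_ is the standard library's.
open EuclideanDomainProperties ℤ-euclideanDomain
  renaming (_∣_ to _∣′_)

∣⇒∣′ : ∀ {d x} → d ∣ x → d ∣′ x
∣⇒∣′ d∣x with Signed.∣ᵤ⇒∣ d∣x
... | Signed.divides k x≡kd = k , x≡kd

∣′⇒∣ : ∀ {d x} → d ∣′ x → d ∣ x
∣′⇒∣ (k , x≡kd) = Signed.∣⇒∣ᵤ (Signed.divides k x≡kd)

∣i∣≡1⇒i≡±1 : ∀ i → ∣ i ∣ ≡ 1 → i ≡ 1ℤ ⊎ i ≡ -1ℤ
∣i∣≡1⇒i≡±1 (+ 1)     refl = inj₁ refl
∣i∣≡1⇒i≡±1 -[1+ 0 ] refl = inj₂ refl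

unit⇒±1 : ∀ {u} → Unit u → u ≡ 1ℤ ⊎ u ≡ -1ℤ
unit⇒±1 {u} (v , uv≡1) =
  ∣i∣≡1⇒i≡±1 u (ℕ.m*n≡1⇒m≡1 ∣ u ∣ ∣ v ∣ (trans (sym (ℤ.abs-* u v)) (cong ∣_∣ uv≡1)))

>1⇒¬unit : ∀ {n} → 1 ℕ.< n → ¬ Unit (+ n)
>1⇒¬unit {n} 1<n (v , nv≡1) =
  ℕ.<⇒≢ 1<n (sym (ℕ.m*n≡1⇒m≡1 n ∣ v ∣ (trans (sym (ℤ.abs-* (+ n) v)) (cong ∣_∣ nv≡1))))

coprime-product-cube : ∀ {x y z} → x ≢ 0ℤ → Coprime x y → x * y ≡ z * z * z → ∃ λ a → x ≡ a * a * a
coprime-product-cube {x} {y} {z} x≢0 coprime xy≡z³ =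
  unit-cube⇒cube (coprime-product-unit-cube {x} {y} {z} x≢0 coprime xy≡z³)
  where
  unit-cube⇒cube : (∃₂ λ u w → Unit u × x ≡ u * (w * w * w)) → ∃ λ a → x ≡ a * a * a
  unit-cube⇒cube (u , w , u-unit , x≡uw³) with unit⇒±1 {u} u-unit
  ... | inj₁ refl = w , trans x≡uw³ (ℤ.*-identityˡ (w * w * w))
  ... | inj₂ refl = - w , trans x≡uw³ (-1*cube w)
    where
    -1*cube : ∀ w → -1ℤ * (w * w * w) ≡ - w * - w * - w
    -1*cube = solve-∀

coprime-triple-product-cube : ∀ {x y z r} → x ≢ 0ℤ → y ≢ 0ℤ → z ≢ 0ℤ →
  Coprime x y → Coprime x z → Coprime y z → x * (y * z) ≡ r * r * r →
  (∃ λ a → x ≡ a * a * a) × (∃ λ b → y ≡ b * b * b) × (∃ λ c → z ≡ c * c * c)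
coprime-triple-product-cube {x} {y} {z} {r} x≢0 y≢0 z≢0 x⊥y x⊥z y⊥z xyz≡r³ =
  coprime-product-cube {x} {y * z} {r} x≢0 (coprime-*ʳ x⊥y x⊥z) xyz≡r³ ,
  coprime-product-cube {y} {x * z} {r} y≢0 (coprime-*ʳ (coprime-sym x⊥y) y⊥z) (trans (lemma₁ x y z) xyz≡r³) ,
  coprime-product-cube {z} {x * y} {r} z≢0 (coprime-*ʳ (coprime-sym x⊥z) (coprime-sym y⊥z)) (trans (lemma₂ x y z) xyz≡r³)
  where
  lemma₁ : ∀ x y z → y * (x * z) ≡ x * (y * z)
  lemma₁ = solve-∀
  lemma₂ : ∀ x y z → z * (x * y) ≡ x * (y * z)
  lemma₂ = solve-∀

gcd≡1⇒coprime : ∀ {p q} → gcd p q ≡ 1ℤ → Coprime p q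
gcd≡1⇒coprime {p} {q} gcd≡1 = ±1-bézout (∣i∣≡1⇒i≡±1 g ∣g∣≡1)
  where
  open GCD (gcd-with-bézout p q) renaming (gcd to g)
  ∣g∣≡1 : ∣ g ∣ ≡ 1
  ∣g∣≡1 = ℕ.∣1⇒≡1 (subst (g ∣_) gcd≡1 (gcd-greatest {p} {q} {g} (∣′⇒∣ {g} {p} gcd∣a) (∣′⇒∣ {g} {q} gcd∣b)))
  ±1-bézout : g ≡ 1ℤ ⊎ g ≡ -1ℤ → Coprime p q
  ±1-bézout (inj₁ g≡1)  = s , t , trans (sym bézout) g≡1
  ±1-bézout (inj₂ g≡-1) = - s , - t , trans (neg-distrib s p t q) (cong -_ (trans (sym bézout) g≡-1))
    where
    neg-distrib : ∀ s p t q → - s * p + - t * q ≡ - (s * p + t * q)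
    neg-distrib = solve-∀

coprime-neg : ∀ {a b} → Coprime a b → Coprime a (- b)
coprime-neg {a} {b} (s , t , sa+tb≡1) = s , - t , trans (lemma s a t b) sa+tb≡1
  where
  lemma : ∀ s a t b → s * a + - t * - b ≡ s * a + t * b
  lemma = solve-∀

coprime-sum-difference : ∀ {p q} → Coprime (p - q) (p + q) → Coprime p q
coprime-sum-difference {p} {q} (s , t , e) = s + t , t - s , trans (lemma s t p q) e
  where
  lemma : ∀ s t p q → (s + t) * p + (t - s) * q ≡ s * (p - q) + t * (p + q)
  lemma = solve-∀

2*x≡x+x : ∀ x → + 2 * x ≡ x + x
2*x≡x+x = solve-∀

double-injective : ∀ {x y} → x + x ≡ y + y → x ≡ y
double-injective {x} {y} 2x≡2y =
  ℤ.*-cancelˡ-≡ (+ 2) x y (trans (2*x≡x+x x) (trans 2x≡2y (sym (2*x≡x+x y))))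

cube≡0⇒≡0 : ∀ {x} → x * x * x ≡ 0ℤ → x ≡ 0ℤ
cube≡0⇒≡0 {x} x³≡0 with ℤ.i*j≡0⇒i≡0∨j≡0 (x * x) x³≡0
... | inj₂ x≡0  = x≡0
... | inj₁ x²≡0 with ℤ.i*j≡0⇒i≡0∨j≡0 x x²≡0
...   | inj₁ x≡0 = x≡0
...   | inj₂ x≡0 = x≡0

∣cube∣ : ∀ x → ∣ x * x * x ∣ ≡ ∣ x ∣ ℕ.* ∣ x ∣ ℕ.* ∣ x ∣
∣cube∣ x = trans (ℤ.abs-* (x * x) x) (cong (ℕ._* ∣ x ∣) (ℤ.abs-* x x))

≢0⇒∣∣≥1 : ∀ {x} → x ≢ 0ℤ → 1 ℕ.≤ ∣ x ∣
≢0⇒∣∣≥1 x≢0 = ℕ.n≢0⇒n>0 (λ ∣x∣≡0 → x≢0 (ℤ.∣i∣≡0⇒i≡0 ∣x∣≡0))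

square≡∣∣² : ∀ i → i * i ≡ + (∣ i ∣ ℕ.* ∣ i ∣)
square≡∣∣² (+ n)    = sym (ℤ.pos-* n n)
square≡∣∣² -[1+ n ] = refl

x²+3y²≡ : ∀ x y → x * x + + 3 * (y * y) ≡ + (∣ x ∣ ℕ.* ∣ x ∣ ℕ.+ 3 ℕ.* (∣ y ∣ ℕ.* ∣ y ∣))
x²+3y²≡ x y = begin
  x * x + + 3 * (y * y)             ≡⟨ cong₂ (λ u v → u + + 3 * v) (square≡∣∣² x) (square≡∣∣² y) ⟩
  + (X ℕ.* X) + + 3 * + (Y ℕ.* Y)   ≡⟨ cong (λ c → + (X ℕ.* X) + c) (sym (ℤ.pos-* 3 (Y ℕ.* Y))) ⟩
  + (X ℕ.* X) + + (3 ℕ.* (Y ℕ.* Y)) ≡⟨ sym (ℤ.pos-+ (X ℕ.* X) (3 ℕ.* (Y ℕ.* Y))) ⟩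
  + (X ℕ.* X ℕ.+ 3 ℕ.* (Y ℕ.* Y))   ∎
  where
  X = ∣ x ∣
  Y = ∣ y ∣

∣x²+3y²∣≥3 : ∀ x {y} → y ≢ 0ℤ → 3 ℕ.≤ ∣ x * x + + 3 * (y * y) ∣
∣x²+3y²∣≥3 x {y} y≢0 = subst (3 ℕ.≤_) (sym (cong ∣_∣ (x²+3y²≡ x y)))
  (ℕ.≤-trans (ℕ.*-monoʳ-≤ 3 (ℕ.*-mono-≤ (≢0⇒∣∣≥1 y≢0) (≢0⇒∣∣≥1 y≢0))) (ℕ.m≤n+m _ (∣ x ∣ ℕ.* ∣ x ∣)))

cube-< : ∀ {A T M} → 1 ℕ.≤ A → 2 ℕ.≤ M → T ℕ.* T ℕ.* T ≡ A ℕ.* A ℕ.* A ℕ.* M → A ℕ.< T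
cube-< {A} {T} {M} 1≤A 2≤M T³≡A³M = ℕ.≰⇒> T≰A
  where
  A³≥1 : 1 ℕ.≤ A ℕ.* A ℕ.* A
  A³≥1 = ℕ.*-mono-≤ (ℕ.*-mono-≤ 1≤A 1≤A) 1≤A
  T≰A : ¬ T ℕ.≤ A
  T≰A T≤A = ℕ.<⇒≱ (ℕ.m<m*n (A ℕ.* A ℕ.* A) M {{ℕ.>-nonZero A³≥1}} 2≤M)
                  (subst (ℕ._≤ A ℕ.* A ℕ.* A) T³≡A³M (ℕ.*-mono-≤ (ℕ.*-mono-≤ T≤A T≤A) T≤A))

smaller-cube-root : ∀ {a θ m} → a ≢ 0ℤ → 2 ℕ.≤ ∣ m ∣ → θ * θ * θ ≡ a * a * a * m → ∣ a ∣ ℕ.< ∣ θ ∣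
smaller-cube-root {a} {θ} {m} a≢0 2≤∣m∣ θ³≡a³m = cube-< (≢0⇒∣∣≥1 a≢0) 2≤∣m∣ (begin
  ∣ θ ∣ ℕ.* ∣ θ ∣ ℕ.* ∣ θ ∣         ≡⟨ sym (∣cube∣ θ) ⟩
  ∣ θ * θ * θ ∣                     ≡⟨ cong ∣_∣ θ³≡a³m ⟩
  ∣ a * a * a * m ∣                 ≡⟨ ℤ.abs-* (a * a * a) m ⟩
  ∣ a * a * a ∣ ℕ.* ∣ m ∣           ≡⟨ cong (ℕ._* ∣ m ∣) (∣cube∣ a) ⟩
  ∣ a ∣ ℕ.* ∣ a ∣ ℕ.* ∣ a ∣ ℕ.* ∣ m ∣ ∎)

data Parity (x : ℤ) : Bool → Set where
  even : ∀ k → x ≡ k + k       → Parity x false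
  odd  : ∀ k → x ≡ k + k + 1ℤ → Parity x true

Even Odd : ℤ → Set
Even x = Parity x false
Odd  x = Parity x true

parity : ∀ x → ∃ (Parity x)
parity x with x % + 2 | n%d<d x (+ 2) | a≡a%n+[a/n]*n x (+ 2)
... | 0 | _ | x≡0+2k = false , even (x / + 2) (trans x≡0+2k (lemma₀ (x / + 2)))
  where
  lemma₀ : ∀ k → + 0 + k * + 2 ≡ k + k
  lemma₀ = solve-∀
... | 1 | _ | x≡1+2k = true  , odd  (x / + 2) (trans x≡1+2k (lemma₁ (x / + 2)))
  where
  lemma₁ : ∀ k → + 1 + k * + 2 ≡ k + k + 1ℤ
  lemma₁ = solve-∀
... | suc (suc _) | s≤s (s≤s ()) | _

3-odd : Odd (+ 3)
3-odd = odd 1ℤ refl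

even≢odd : ∀ k l → k + k ≢ l + l + 1ℤ
even≢odd k l 2k≡2l+1 = >1⇒¬unit {2} (s≤s (s≤s z≤n)) (k - l , (begin
  + 2 * (k - l)            ≡⟨ solve (k ∷ l ∷ []) ⟩
  k + k - (l + l)          ≡⟨ cong (_- (l + l)) 2k≡2l+1 ⟩
  l + l + 1ℤ - (l + l)     ≡⟨ solve (l ∷ []) ⟩
  1ℤ                       ∎))

parity-unique : ∀ {x b c} → Parity x b → Parity x c → b ≡ c
parity-unique (even _ _)   (even _ _)   = refl
parity-unique (odd _ _)    (odd _ _)    = refl
parity-unique (even k x≡2k) (odd l x≡2l+1) = ⊥-elim (even≢odd k l (trans (sym x≡2k) x≡2l+1))
parity-unique (odd k x≡2k+1) (even l x≡2l) = ⊥-elim (even≢odd l k (trans (sym x≡2l) x≡2k+1))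

parity-+ : ∀ {x y b c} → Parity x b → Parity y c → Parity (x + y) (b xor c)
parity-+ (even k refl) (even l refl) = even (k + l) (solve (k ∷ l ∷ []))
parity-+ (even k refl) (odd l refl)  = odd (k + l) (solve (k ∷ l ∷ []))
parity-+ (odd k refl)  (even l refl) = odd (k + l) (solve (k ∷ l ∷ []))
parity-+ (odd k refl)  (odd l refl)  = even (k + l + 1ℤ) (solve (k ∷ l ∷ []))

parity-* : ∀ {x y b c} → Parity x b → Parity y c → Parity (x * y) (b ∧ c)
parity-* (even k refl) (even l refl) = even (k * (l + l)) (solve (k ∷ l ∷ []))
parity-* (even k refl) (odd l refl)  = even (k * (l + l + 1ℤ)) (solve (k ∷ l ∷ []))
parity-* (odd k refl)  (even l refl) = even ((k + k + 1ℤ) * l) (solve (k ∷ l ∷ []))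
parity-* (odd k refl)  (odd l refl)  = odd (k * l + k * l + k + l) (solve (k ∷ l ∷ []))

parity-neg : ∀ {x b} → Parity x b → Parity (- x) b
parity-neg (even k refl) = even (- k) (solve (k ∷ []))
parity-neg (odd k refl)  = odd (- k - 1ℤ) (solve (k ∷ []))

parity-+-cancelʳ : ∀ {x y b c} → Parity (x + y) b → Parity y c → Parity x (b xor c)
parity-+-cancelʳ {x} {y} x+y-b y-c = subst (λ x → Parity x _) (sym (lemma x y)) (parity-+ x+y-b (parity-neg y-c))
  where
  lemma : ∀ x y → x ≡ x + y + - y
  lemma = solve-∀

-- (b ∧ b) ∧ b reduces to b only for a concrete b.
parity-cube : ∀ {x b} → Parity x b → Parity (x * x * x) b
parity-cube {b = false} px = parity-* (parity-* px px) px
parity-cube {b = true}  px = parity-* (parity-* px px) px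

odd-cube⇒odd : ∀ {x} → Odd (x * x * x) → Odd x
odd-cube⇒odd {x} x³-odd with parity x
... | true  , px = px
... | false , px with parity-unique x³-odd (parity-cube px)
... | ()

twice-odd≢cube : ∀ {m θ} → Odd m → m + m ≢ θ * θ * θ
twice-odd≢cube {m} {θ} m-odd 2m≡θ³ = θ-parity (parity θ)
  where
  θ-parity : ∃ (Parity θ) → ⊥
  θ-parity (true , θ-odd) with parity-unique (parity-cube θ-odd) (subst (λ x → Parity x false) 2m≡θ³ (even m refl))
  ... | ()
  θ-parity (false , even k refl) with parity-unique m-odd (even (k * k * k + k * k * k) m≡4k³)
    where
    m≡4k³ : m ≡ k * k * k + k * k * k + (k * k * k + k * k * k)
    m≡4k³ = double-injective (trans 2m≡θ³ (lemma k))
      where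
      lemma : ∀ k → (k + k) * (k + k) * (k + k)
                  ≡ k * k * k + k * k * k + (k * k * k + k * k * k) + (k * k * k + k * k * k + (k * k * k + k * k * k))
      lemma = solve-∀
  ... | ()

odd≢0 : ∀ {x} → Odd x → x ≢ 0ℤ
odd≢0 (odd k x≡2k+1) x≡0 = even≢odd 0ℤ k (trans (sym x≡0) x≡2k+1)

u-3v≢u+3v : ∀ {u v} → Odd v → u - + 3 * v ≢ u + + 3 * v
u-3v≢u+3v {u} {v} v-odd X₂≡X₃ = odd≢0 v-odd (6v≡0⇒v≡0 (begin
  + 6 * v                             ≡⟨ lemma u v ⟩
  u + + 3 * v - (u - + 3 * v)         ≡⟨ cong (λ x → u + + 3 * v - x) X₂≡X₃ ⟩
  u + + 3 * v - (u + + 3 * v)         ≡⟨ ℤ.+-inverseʳ (u + + 3 * v) ⟩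
  0ℤ                                  ∎))
  where
  lemma : ∀ u v → + 6 * v ≡ u + + 3 * v - (u - + 3 * v)
  lemma = solve-∀
  6v≡0⇒v≡0 : + 6 * v ≡ 0ℤ → v ≡ 0ℤ
  6v≡0⇒v≡0 6v≡0 with ℤ.i*j≡0⇒i≡0∨j≡0 (+ 6) 6v≡0
  ... | inj₂ v≡0 = v≡0

even⇒2∣ : ∀ {x} → Even x → + 2 ∣ x
even⇒2∣ (even k x≡2k) = ∣′⇒∣ (k , trans x≡2k (solve (k ∷ [])))

2∣⇒even : ∀ {x} → + 2 ∣ x → Even x
2∣⇒even 2∣x with ∣⇒∣′ 2∣x
... | k , x≡2k = even k (trans x≡2k (solve (k ∷ [])))

¬2∣⇒odd : ∀ {x} → ¬ (+ 2 ∣ x) → Odd x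
¬2∣⇒odd {x} 2∤x with parity x
... | true  , x-odd  = x-odd
... | false , x-even = ⊥-elim (2∤x (even⇒2∣ x-even))

odd⇒coprime-2 : ∀ {x} → Odd x → Coprime (+ 2) x
odd⇒coprime-2 (odd k refl) = - k , 1ℤ , lemma k
  where
  lemma : ∀ k → - k * + 2 + 1ℤ * (k + k + 1ℤ) ≡ 1ℤ
  lemma = solve-∀

coprime⇒∤ : ∀ {n x} → 1 ℕ.< n → Coprime (+ n) x → ¬ (+ n ∣ x)
coprime⇒∤ 1<n coprime n∣x = >1⇒¬unit 1<n (common-divisor-unit ∣-refl (∣⇒∣′ n∣x) coprime)

coprime⇒¬common-divisor : ∀ {n p q} → 1 ℕ.< n → Coprime p q → + n ∣ p → ¬ (+ n ∣ q)
coprime⇒¬common-divisor {n} {p} {q} 1<n p⊥q n∣p =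
  coprime⇒∤ 1<n (coprime-divisors {+ n} {q} {p} {q} (∣⇒∣′ {+ n} {p} n∣p) ∣-refl p⊥q)

3∣⊎coprime : ∀ x → + 3 ∣ x ⊎ Coprime (+ 3) x
3∣⊎coprime x with x % + 3 | n%d<d x (+ 3) | a≡a%n+[a/n]*n x (+ 3)
... | 0 | _ | x≡3k   = inj₁ (∣′⇒∣ {+ 3} {x} (x / + 3 , trans x≡3k (ℤ.+-identityˡ (x / + 3 * + 3))))
... | 1 | _ | x≡1+3k = inj₂ (- (x / + 3) , 1ℤ , trans (cong (λ x → - k * + 3 + 1ℤ * x) x≡1+3k) (lemma₁ k))
  where
  k = x / + 3
  lemma₁ : ∀ k → - k * + 3 + 1ℤ * (+ 1 + k * + 3) ≡ 1ℤ
  lemma₁ = solve-∀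
... | 2 | _ | x≡2+3k = inj₂ (k + 1ℤ , -1ℤ , trans (cong (λ x → (k + 1ℤ) * + 3 + -1ℤ * x) x≡2+3k) (lemma₂ k))
  where
  k = x / + 3
  lemma₂ : ∀ k → (k + 1ℤ) * + 3 + -1ℤ * (+ 2 + k * + 3) ≡ 1ℤ
  lemma₂ = solve-∀
... | suc (suc (suc _)) | s≤s (s≤s (s≤s ())) | _

∤3⇒coprime : ∀ {x} → ¬ (+ 3 ∣ x) → Coprime (+ 3) x
∤3⇒coprime {x} 3∤x with 3∣⊎coprime x
... | inj₁ 3∣x     = ⊥-elim (3∤x 3∣x)
... | inj₂ coprime = coprime

3∣cube⇒3∣ : ∀ {x} → + 3 ∣ x * x * x → + 3 ∣ x
3∣cube⇒3∣ {x} 3∣x³ with 3∣⊎coprime x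
... | inj₁ 3∣x     = 3∣x
... | inj₂ coprime =
  ⊥-elim (coprime⇒∤ {3} {x * x * x} (s≤s (s≤s z≤n)) (coprime-*ʳ (coprime-*ʳ coprime coprime) coprime) 3∣x³)

-- The Eisenstein integers ℤ[ω]

-- ⟨ a , b ⟩ represents a + bω, where ω² = - 1 - ω.
record ℤ[ω] : Set where
  constructor ⟨_,_⟩
  field re im : ℤ
open ℤ[ω]

infixl 6 _⊕_
infixl 7 _⊗_
infix  8 ⊖_

_⊕_ : ℤ[ω] → ℤ[ω] → ℤ[ω]
⟨ a , b ⟩ ⊕ ⟨ c , d ⟩ = ⟨ a + c , b + d ⟩

_⊗_ : ℤ[ω] → ℤ[ω] → ℤ[ω]
⟨ a , b ⟩ ⊗ ⟨ c , d ⟩ = ⟨ a * c - b * d , a * d + b * c - b * d ⟩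

⊖_ : ℤ[ω] → ℤ[ω]
⊖ ⟨ a , b ⟩ = ⟨ - a , - b ⟩

ι : ℤ → ℤ[ω]
ι a = ⟨ a , 0ℤ ⟩

0ω 1ω ω ω² : ℤ[ω]
0ω = ι 0ℤ
1ω = ι 1ℤ
ω  = ⟨ 0ℤ , 1ℤ ⟩
ω² = ⟨ -1ℤ , -1ℤ ⟩

⊗-comm : ∀ x y → x ⊗ y ≡ y ⊗ x
⊗-comm ⟨ a , b ⟩ ⟨ c , d ⟩ = cong₂ ⟨_,_⟩ (solve (a ∷ b ∷ c ∷ d ∷ [])) (solve (a ∷ b ∷ c ∷ d ∷ []))

⊗-assoc : ∀ x y z → (x ⊗ y) ⊗ z ≡ x ⊗ (y ⊗ z)
⊗-assoc ⟨ a , b ⟩ ⟨ c , d ⟩ ⟨ e , f ⟩ = cong₂ ⟨_,_⟩ (re-assoc a b c d e f) (im-assoc a b c d e f)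
  where
  re-assoc : ∀ a b c d e f → (a * c - b * d) * e - (a * d + b * c - b * d) * f
                            ≡ a * (c * e - d * f) - b * (c * f + d * e - d * f)
  re-assoc = solve-∀
  im-assoc : ∀ a b c d e f → (a * c - b * d) * f + (a * d + b * c - b * d) * e - (a * d + b * c - b * d) * f
                            ≡ a * (c * f + d * e - d * f) + b * (c * e - d * f) - b * (c * f + d * e - d * f)
  im-assoc = solve-∀

⊗-identityˡ : ∀ x → 1ω ⊗ x ≡ x
⊗-identityˡ ⟨ a , b ⟩ = cong₂ ⟨_,_⟩ (solve (a ∷ b ∷ [])) (solve (a ∷ b ∷ []))

⊗-distribˡ-⊕ : ∀ x y z → x ⊗ (y ⊕ z) ≡ x ⊗ y ⊕ x ⊗ z
⊗-distribˡ-⊕ ⟨ a , b ⟩ ⟨ c , d ⟩ ⟨ e , f ⟩ = cong₂ ⟨_,_⟩ (re-distrib a b c d e f) (im-distrib a b c d e f)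
  where
  re-distrib : ∀ a b c d e f → a * (c + e) - b * (d + f) ≡ (a * c - b * d) + (a * e - b * f)
  re-distrib = solve-∀
  im-distrib : ∀ a b c d e f → a * (d + f) + b * (c + e) - b * (d + f)
                              ≡ (a * d + b * c - b * d) + (a * f + b * e - b * f)
  im-distrib = solve-∀

ι-⊗ : ∀ a b → ι (a * b) ≡ ι a ⊗ ι b
ι-⊗ a b = cong₂ ⟨_,_⟩ (re-lemma a b) (im-lemma a b)
  where
  re-lemma : ∀ a b → a * b ≡ a * b - 0ℤ * 0ℤ
  re-lemma = solve-∀
  im-lemma : ∀ a b → 0ℤ ≡ a * 0ℤ + 0ℤ * b - 0ℤ * 0ℤ
  im-lemma = solve-∀

ℤ[ω]-isCommutativeRing : IsCommutativeRing _≡_ _⊕_ _⊗_ ⊖_ 0ω 1ω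
ℤ[ω]-isCommutativeRing = record
  { isRing = record
    { +-isAbelianGroup = record
      { isGroup = record
        { isMonoid = record
          { isSemigroup = record
            { isMagma = record { isEquivalence = isEquivalence ; ∙-cong = cong₂ _⊕_ }
            ; assoc = λ { ⟨ a , b ⟩ ⟨ c , d ⟩ ⟨ e , f ⟩ → cong₂ ⟨_,_⟩ (ℤ.+-assoc a c e) (ℤ.+-assoc b d f) } }
          ; identity = (λ { ⟨ a , b ⟩ → cong₂ ⟨_,_⟩ (ℤ.+-identityˡ a) (ℤ.+-identityˡ b) })
                     , (λ { ⟨ a , b ⟩ → cong₂ ⟨_,_⟩ (ℤ.+-identityʳ a) (ℤ.+-identityʳ b) }) }
        ; inverse = (λ { ⟨ a , b ⟩ → cong₂ ⟨_,_⟩ (ℤ.+-inverseˡ a) (ℤ.+-inverseˡ b) })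
                  , (λ { ⟨ a , b ⟩ → cong₂ ⟨_,_⟩ (ℤ.+-inverseʳ a) (ℤ.+-inverseʳ b) })
        ; ⁻¹-cong = cong ⊖_ }
      ; comm = λ { ⟨ a , b ⟩ ⟨ c , d ⟩ → cong₂ ⟨_,_⟩ (ℤ.+-comm a c) (ℤ.+-comm b d) } }
    ; *-cong = cong₂ _⊗_
    ; *-assoc = ⊗-assoc
    ; *-identity = ⊗-identityˡ , λ x → trans (⊗-comm x 1ω) (⊗-identityˡ x)
    ; distrib = ⊗-distribˡ-⊕
              , λ x y z → trans (⊗-comm (y ⊕ z) x) (trans (⊗-distribˡ-⊕ x y z) (cong₂ _⊕_ (⊗-comm x y) (⊗-comm x z))) }
  ; *-comm = ⊗-comm }

ℤ[ω]-ring : AlmostCommutativeRing _ _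
ℤ[ω]-ring = fromCommutativeRing (record { isCommutativeRing = ℤ[ω]-isCommutativeRing })
  λ { ⟨ +0 , +0 ⟩ → just refl ; _ → nothing }

norm : ℤ[ω] → ℤ
norm ⟨ a , b ⟩ = a * a - a * b + b * b

conj : ℤ[ω] → ℤ[ω]
conj ⟨ a , b ⟩ = ⟨ a - b , - b ⟩

norm-⊗ : ∀ x y → norm (x ⊗ y) ≡ norm x * norm y
norm-⊗ ⟨ a , b ⟩ ⟨ c , d ⟩ = lemma a b c d
  where
  lemma : ∀ a b c d → (a * c - b * d) * (a * c - b * d) - (a * c - b * d) * (a * d + b * c - b * d)
                      + (a * d + b * c - b * d) * (a * d + b * c - b * d)
                      ≡ (a * a - a * b + b * b) * (c * c - c * d + d * d)
  lemma = solve-∀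

norm-conj : ∀ x → norm (conj x) ≡ norm x
norm-conj ⟨ a , b ⟩ = lemma a b
  where
  lemma : ∀ a b → (a - b) * (a - b) - (a - b) * - b + - b * - b ≡ a * a - a * b + b * b
  lemma = solve-∀

⊗-conj : ∀ x → x ⊗ conj x ≡ ι (norm x)
⊗-conj ⟨ a , b ⟩ = cong₂ ⟨_,_⟩ (re-lemma a b) (im-lemma a b)
  where
  re-lemma : ∀ a b → a * (a - b) - b * - b ≡ a * a - a * b + b * b
  re-lemma = solve-∀
  im-lemma : ∀ a b → a * - b + b * (a - b) - b * - b ≡ 0ℤ
  im-lemma = solve-∀

4*norm≡ : ∀ a b → + 4 * norm ⟨ a , b ⟩
                ≡ + (∣ a + a - b ∣ ℕ.* ∣ a + a - b ∣ ℕ.+ 3 ℕ.* (∣ b ∣ ℕ.* ∣ b ∣))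
4*norm≡ a b = trans (lemma a b) (x²+3y²≡ (a + a - b) b)
  where
  lemma : ∀ a b → + 4 * (a * a - a * b + b * b) ≡ (a + a - b) * (a + a - b) + + 3 * (b * b)
  lemma = solve-∀

norm-nonneg : ∀ x → norm x ≡ + ∣ norm x ∣
norm-nonneg ⟨ a , b ⟩ with norm ⟨ a , b ⟩ | 4*norm≡ a b
... | + n      | _  = refl
... | -[1+ n ] | ()

n*n≡0⇒n≡0 : ∀ n → n ℕ.* n ≡ 0 → n ≡ 0
n*n≡0⇒n≡0 zero _ = refl

norm≡0⇒≡0 : ∀ x → norm x ≡ 0ℤ → x ≡ 0ω
norm≡0⇒≡0 ⟨ a , b ⟩ norm≡0 = cong₂ ⟨_,_⟩ a≡0 b≡0
  where
  A = ∣ a + a - b ∣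
  B = ∣ b ∣
  A²+3B²≡0 : A ℕ.* A ℕ.+ 3 ℕ.* (B ℕ.* B) ≡ 0
  A²+3B²≡0 = ℤ.+-injective (trans (sym (4*norm≡ a b)) (cong (+ 4 *_) norm≡0))
  b≡0 : b ≡ 0ℤ
  b≡0 = ℤ.∣i∣≡0⇒i≡0 (n*n≡0⇒n≡0 B (ℕ.m*n≡0⇒m≡0 (B ℕ.* B) 3
          (trans (ℕ.*-comm (B ℕ.* B) 3) (ℕ.m+n≡0⇒n≡0 (A ℕ.* A) A²+3B²≡0))))
  2a-b≡0 : a + a - b ≡ 0ℤ
  2a-b≡0 = ℤ.∣i∣≡0⇒i≡0 (n*n≡0⇒n≡0 A (ℕ.m+n≡0⇒m≡0 (A ℕ.* A) A²+3B²≡0))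
  a≡0 : a ≡ 0ℤ
  a≡0 = ℤ.*-cancelʳ-≡ a 0ℤ (+ 2) (begin
    a * + 2         ≡⟨ lemma a b ⟩
    a + a - b + b   ≡⟨ cong₂ _+_ 2a-b≡0 b≡0 ⟩
    0ℤ              ≡⟨⟩
    0ℤ * + 2        ∎)
    where
    lemma : ∀ a b → a * + 2 ≡ a + a - b + b
    lemma = solve-∀

⊗-cancelˡ-≡ : ∀ x {y z} → x ≢ 0ω → x ⊗ y ≡ x ⊗ z → y ≡ z
⊗-cancelˡ-≡ x {y} {z} x≢0 xy≡xz =
  [ (λ Nx≡0 → ⊥-elim (x≢0 (norm≡0⇒≡0 x Nx≡0)))
  , (λ Ny-z≡0 → begin
      y                 ≡⟨ sub-add y z ⟩
      (y ⊕ ⊖ z) ⊕ z     ≡⟨ cong (_⊕ z) (norm≡0⇒≡0 (y ⊕ ⊖ z) Ny-z≡0) ⟩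
      0ω ⊕ z            ≡⟨ cong₂ ⟨_,_⟩ (ℤ.+-identityˡ (re z)) (ℤ.+-identityˡ (im z)) ⟩
      z                 ∎)
  ]′ (ℤ.i*j≡0⇒i≡0∨j≡0 (norm x) (begin
       norm x * norm (y ⊕ ⊖ z)    ≡⟨ sym (norm-⊗ x (y ⊕ ⊖ z)) ⟩
       norm (x ⊗ (y ⊕ ⊖ z))       ≡⟨ cong norm (mul-sub x y z) ⟩
       norm (x ⊗ y ⊕ ⊖ (x ⊗ z))   ≡⟨ cong (λ u → norm (u ⊕ ⊖ (x ⊗ z))) xy≡xz ⟩
       norm (x ⊗ z ⊕ ⊖ (x ⊗ z))   ≡⟨ cong norm (sub-self (x ⊗ z)) ⟩
       0ℤ                          ∎))
  where
  sub-add : ∀ y z → y ≡ (y ⊕ ⊖ z) ⊕ z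
  sub-add = RingSolver.solve-∀ ℤ[ω]-ring
  mul-sub : ∀ x y z → x ⊗ (y ⊕ ⊖ z) ≡ x ⊗ y ⊕ ⊖ (x ⊗ z)
  mul-sub = RingSolver.solve-∀ ℤ[ω]-ring
  sub-self : ∀ u → u ⊕ ⊖ u ≡ 0ω
  sub-self = RingSolver.solve-∀ ℤ[ω]-ring

n₁²+n₂²<D²+n₁n₂ : ∀ {n₁ n₂ D} → n₁ ℕ.< D → n₂ ℕ.< D →
                  n₁ ℕ.* n₁ ℕ.+ n₂ ℕ.* n₂ ℕ.< D ℕ.* D ℕ.+ n₁ ℕ.* n₂
n₁²+n₂²<D²+n₁n₂ {n₁} {n₂} {D} n₁<D n₂<D with ℕ.≤-total n₂ n₁
... | inj₁ n₂≤n₁ = ℕ.+-mono-<-≤ (ℕ.*-mono-< n₁<D n₁<D) (ℕ.*-monoˡ-≤ n₂ n₂≤n₁)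
... | inj₂ n₁≤n₂ = subst (n₁ ℕ.* n₁ ℕ.+ n₂ ℕ.* n₂ ℕ.<_) (ℕ.+-comm (n₁ ℕ.* n₂) (D ℕ.* D))
                     (ℕ.+-mono-≤-< (ℕ.*-monoʳ-≤ n₁ n₁≤n₂) (ℕ.*-mono-< n₂<D n₂<D))

∣norm∣<D² : ∀ {n₁ n₂ D} → n₁ ℕ.< D → n₂ ℕ.< D → ∣ norm ⟨ + n₁ , + n₂ ⟩ ∣ ℕ.< D ℕ.* D
∣norm∣<D² {n₁} {n₂} {D} n₁<D n₂<D =
  ℕ.+-cancelʳ-< (n₁ ℕ.* n₂) _ _
    (subst (ℕ._< D ℕ.* D ℕ.+ n₁ ℕ.* n₂) (sym N+n₁n₂≡) (n₁²+n₂²<D²+n₁n₂ n₁<D n₂<D))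
  where
  N = norm ⟨ + n₁ , + n₂ ⟩
  N+n₁n₂≡ : ∣ N ∣ ℕ.+ n₁ ℕ.* n₂ ≡ n₁ ℕ.* n₁ ℕ.+ n₂ ℕ.* n₂
  N+n₁n₂≡ = ℤ.+-injective (begin
    + (∣ N ∣ ℕ.+ n₁ ℕ.* n₂)                ≡⟨ ℤ.pos-+ ∣ N ∣ (n₁ ℕ.* n₂) ⟩
    + ∣ N ∣ + + (n₁ ℕ.* n₂)                ≡⟨ cong₂ _+_ (sym (norm-nonneg ⟨ + n₁ , + n₂ ⟩)) (ℤ.pos-* n₁ n₂) ⟩
    N + + n₁ * + n₂                        ≡⟨ lemma (+ n₁) (+ n₂) ⟩
    + n₁ * + n₁ + + n₂ * + n₂              ≡⟨ sym (cong₂ _+_ (ℤ.pos-* n₁ n₁) (ℤ.pos-* n₂ n₂)) ⟩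
    + (n₁ ℕ.* n₁) + + (n₂ ℕ.* n₂)          ≡⟨ sym (ℤ.pos-+ (n₁ ℕ.* n₁) (n₂ ℕ.* n₂)) ⟩
    + (n₁ ℕ.* n₁ ℕ.+ n₂ ℕ.* n₂)            ∎)
    where
    lemma : ∀ a b → a * a - a * b + b * b + a * b ≡ a * a + b * b
    lemma = solve-∀

-- q rounds the coordinates of a·b̄ / N(b) down, so the coordinates of r·b̄ lie in [0, N(b)).
⊗-divMod : ∀ a b → b ≢ 0ω → ∃₂ λ q r → a ≡ q ⊗ b ⊕ r × ∣ norm r ∣ ℕ.< ∣ norm b ∣
⊗-divMod a b b≢0 = q , r , add-sub (q ⊗ b) a , ∣Nr∣<D
  where
  d = norm b
  instance _ = ≢-nonZero (λ d≡0 → b≢0 (norm≡0⇒≡0 b d≡0))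
  m = re (a ⊗ conj b)
  n = im (a ⊗ conj b)
  q = ⟨ m / d , n / d ⟩
  r = a ⊕ ⊖ (q ⊗ b)
  D = ∣ d ∣
  add-sub : ∀ u a → a ≡ u ⊕ (a ⊕ ⊖ u)
  add-sub = RingSolver.solve-∀ ℤ[ω]-ring
  r⊗conj-b : r ⊗ conj b ≡ ⟨ + (m % d) , + (n % d) ⟩
  r⊗conj-b = begin
    r ⊗ conj b                              ≡⟨ distrib a q b (conj b) ⟩
    a ⊗ conj b ⊕ ⊖ (q ⊗ (b ⊗ conj b))       ≡⟨ cong (λ c → a ⊗ conj b ⊕ ⊖ (q ⊗ c)) (⊗-conj b) ⟩
    ⟨ m , n ⟩ ⊕ ⊖ (q ⊗ ι d)
      ≡⟨ cong₂ ⟨_,_⟩ (re-lemma m (m / d) (n / d) d) (im-lemma n (m / d) (n / d) d) ⟩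
    ⟨ m - m / d * d , n - n / d * d ⟩       ≡⟨ cong₂ ⟨_,_⟩ (remainder m) (remainder n) ⟩
    ⟨ + (m % d) , + (n % d) ⟩               ∎
    where
    distrib : ∀ a q b c → (a ⊕ ⊖ (q ⊗ b)) ⊗ c ≡ a ⊗ c ⊕ ⊖ (q ⊗ (b ⊗ c))
    distrib = RingSolver.solve-∀ ℤ[ω]-ring
    re-lemma : ∀ m k l d → m + - (k * d - l * 0ℤ) ≡ m - k * d
    re-lemma = solve-∀
    im-lemma : ∀ n k l d → n + - (k * 0ℤ + l * d - l * 0ℤ) ≡ n - l * d
    im-lemma = solve-∀
    remainder : ∀ x → x - x / d * d ≡ + (x % d)
    remainder x = begin
      x - x / d * d                      ≡⟨ cong (_- x / d * d) (a≡a%n+[a/n]*n x d) ⟩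
      + (x % d) + x / d * d - x / d * d   ≡⟨ cancel (+ (x % d)) (x / d * d) ⟩
      + (x % d)                          ∎
      where
      cancel : ∀ r y → r + y - y ≡ r
      cancel = solve-∀
  ∣Nr∣*D≡ : ∣ norm r ∣ ℕ.* D ≡ ∣ norm ⟨ + (m % d) , + (n % d) ⟩ ∣
  ∣Nr∣*D≡ = begin
    ∣ norm r ∣ ℕ.* ∣ norm b ∣          ≡⟨ cong (λ c → ∣ norm r ∣ ℕ.* ∣ c ∣) (sym (norm-conj b)) ⟩
    ∣ norm r ∣ ℕ.* ∣ norm (conj b) ∣   ≡⟨ sym (ℤ.abs-* (norm r) (norm (conj b))) ⟩
    ∣ norm r * norm (conj b) ∣         ≡⟨ cong ∣_∣ (sym (norm-⊗ r (conj b))) ⟩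
    ∣ norm (r ⊗ conj b) ∣              ≡⟨ cong (λ c → ∣ norm c ∣) r⊗conj-b ⟩
    ∣ norm ⟨ + (m % d) , + (n % d) ⟩ ∣ ∎
  ∣Nr∣<D : ∣ norm r ∣ ℕ.< D
  ∣Nr∣<D = ℕ.*-cancelʳ-< D _ _ (subst (ℕ._< D ℕ.* D) (sym ∣Nr∣*D≡) (∣norm∣<D² (n%d<d m d) (n%d<d n d)))

_≟0ω : ∀ x → Dec (x ≡ 0ω)
⟨ a , b ⟩ ≟0ω with a ≟ 0ℤ | b ≟ 0ℤ
... | yes refl | yes refl = yes refl
... | no a≢0   | _        = no (λ x≡0 → a≢0 (cong re x≡0))
... | yes _    | no b≢0   = no (λ x≡0 → b≢0 (cong im x≡0))

ℤ[ω]-euclideanDomain : EuclideanDomain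
ℤ[ω]-euclideanDomain = record
  { isCommutativeRing = ℤ[ω]-isCommutativeRing
  ; _≟0 = _≟0ω
  ; *-cancelˡ-≡ = ⊗-cancelˡ-≡
  ; size = λ x → ∣ norm x ∣
  ; divMod = ⊗-divMod
  }

-- Euler's parametrisation

module Eisenstein = EuclideanDomainProperties ℤ[ω]-euclideanDomain

-- F₄ = ℤ[ω]/(2) = F₂[ω], with (b₀ , b₁) standing for b₀ + b₁ω.
F₄ : Set
F₄ = Bool × Bool

0₄ 1₄ : F₄
0₄ = false , false
1₄ = true , false

infixl 7 _·_
_·_ : F₄ → F₄ → F₄
(a , b) · (c , d) = (a ∧ c) xor (b ∧ d) , ((a ∧ d) xor (b ∧ c)) xor (b ∧ d)

Reduces : ℤ[ω] → F₄ → Set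
Reduces x (b₀ , b₁) = Parity (re x) b₀ × Parity (im x) b₁

reduction : ∀ x → ∃ (Reduces x)
reduction x with parity (re x) | parity (im x)
... | b₀ , re-b₀ | b₁ , im-b₁ = (b₀ , b₁) , re-b₀ , im-b₁

reduces-unique : ∀ {x c d} → Reduces x c → Reduces x d → c ≡ d
reduces-unique {c = _ , _} {d = _ , _} (re-c₀ , im-c₁) (re-d₀ , im-d₁) =
  cong₂ _,_ (parity-unique re-c₀ re-d₀) (parity-unique im-c₁ im-d₁)

reduces-⊗ : ∀ {x y c d} → Reduces x c → Reduces y d → Reduces (x ⊗ y) (c · d)
reduces-⊗ {c = _ , _} {d = _ , _} (ra , rb) (rc , rd) =
  parity-+ (parity-* ra rc) (parity-neg (parity-* rb rd)) ,
  parity-+ (parity-+ (parity-* ra rd) (parity-* rb rc)) (parity-neg (parity-* rb rd))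

reduces-⊖ : ∀ {x c} → Reduces x c → Reduces (⊖ x) c
reduces-⊖ {c = _ , _} (ra , rb) = parity-neg ra , parity-neg rb

-- Every nonzero element of F₄ has cube 1.
unit·cube≡1 : ∀ c d → c · (d · d · d) ≡ 1₄ → c ≡ 1₄ × d ≢ 0₄
unit·cube≡1 (true  , false) (true  , false) _ = refl , λ ()
unit·cube≡1 (true  , false) (false , true)  _ = refl , λ ()
unit·cube≡1 (true  , false) (true  , true)  _ = refl , λ ()
unit·cube≡1 (true  , false) (false , false) ()
unit·cube≡1 (false , false) (_     , _)     ()
unit·cube≡1 (false , true)  (true  , false) ()
unit·cube≡1 (false , true)  (false , true)  ()
unit·cube≡1 (false , true)  (true  , true)  ()
unit·cube≡1 (false , true)  (false , false) ()
unit·cube≡1 (true  , true)  (true  , false) ()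
unit·cube≡1 (true  , true)  (false , true)  ()
unit·cube≡1 (true  , true)  (true  , true)  ()
unit·cube≡1 (true  , true)  (false , false) ()

unit⇒norm≡1 : ∀ {k} → Eisenstein.Unit k → ∣ norm k ∣ ≡ 1
unit⇒norm≡1 {k} (v , kv≡1) = ℕ.m*n≡1⇒m≡1 ∣ norm k ∣ ∣ norm v ∣ (begin
  ∣ norm k ∣ ℕ.* ∣ norm v ∣ ≡⟨ sym (ℤ.abs-* (norm k) (norm v)) ⟩
  ∣ norm k * norm v ∣       ≡⟨ cong ∣_∣ (sym (norm-⊗ k v)) ⟩
  ∣ norm (k ⊗ v) ∣          ≡⟨ cong (λ x → ∣ norm x ∣) kv≡1 ⟩
  1                         ∎)

x²+3y²≡1 : ∀ x y → x ℕ.* x ℕ.+ 3 ℕ.* (y ℕ.* y) ≡ 1 → x ≡ 1 × y ≡ 0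
x²+3y²≡1 x zero    x²≡1 = ℕ.m*n≡1⇒m≡1 x x (trans (sym (ℕ.+-identityʳ (x ℕ.* x))) x²≡1) , refl
x²+3y²≡1 x (suc y) x²+3y²≡1
  with ℕ.≤-trans (ℕ.*-monoʳ-≤ 3 (s≤s z≤n))
                 (ℕ.≤-trans (ℕ.m≤n+m (3 ℕ.* (suc y ℕ.* suc y)) (x ℕ.* x)) (ℕ.≤-reflexive x²+3y²≡1))
... | s≤s ()

-- Among the units ±1, ±ω, ±ω², only ±1 reduce to 1 modulo 2.
unit-reducing-to-1 : ∀ {k} → Eisenstein.Unit k → Reduces k 1₄ → k ≡ 1ω ⊎ k ≡ ⊖ 1ω
unit-reducing-to-1 {⟨ a , b ⟩} k-unit (_ , even l b≡l+l) = ±1 (∣i∣≡1⇒i≡±1 a ∣a∣≡1)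
  where
  E = ∣ a - l ∣
  L = ∣ l ∣
  E²+3L²≡1 : E ℕ.* E ℕ.+ 3 ℕ.* (L ℕ.* L) ≡ 1
  E²+3L²≡1 = ℤ.+-injective (begin
    + (E ℕ.* E ℕ.+ 3 ℕ.* (L ℕ.* L))     ≡⟨ sym (x²+3y²≡ (a - l) l) ⟩
    (a - l) * (a - l) + + 3 * (l * l)  ≡⟨ lemma a l ⟩
    norm ⟨ a , l + l ⟩                 ≡⟨ cong (λ b → norm ⟨ a , b ⟩) (sym b≡l+l) ⟩
    norm ⟨ a , b ⟩                     ≡⟨ norm-nonneg ⟨ a , b ⟩ ⟩
    + ∣ norm ⟨ a , b ⟩ ∣               ≡⟨ cong +_ (unit⇒norm≡1 {⟨ a , b ⟩} k-unit) ⟩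
    + 1                                ∎)
    where
    lemma : ∀ a l → (a - l) * (a - l) + + 3 * (l * l) ≡ a * a - a * (l + l) + (l + l) * (l + l)
    lemma = solve-∀
  l≡0 : l ≡ 0ℤ
  l≡0 = ℤ.∣i∣≡0⇒i≡0 (proj₂ (x²+3y²≡1 E L E²+3L²≡1))
  ∣a∣≡1 : ∣ a ∣ ≡ 1
  ∣a∣≡1 = trans (cong ∣_∣ (sym (ℤ.+-identityʳ a)))
                (subst (λ l → ∣ a - l ∣ ≡ 1) l≡0 (proj₁ (x²+3y²≡1 E L E²+3L²≡1)))
  b≡0 : b ≡ 0ℤ
  b≡0 = trans b≡l+l (cong (λ l → l + l) l≡0)
  ±1 : a ≡ 1ℤ ⊎ a ≡ -1ℤ → ⟨ a , b ⟩ ≡ 1ω ⊎ ⟨ a , b ⟩ ≡ ⊖ 1ω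
  ±1 (inj₁ a≡1)  = inj₁ (cong₂ ⟨_,_⟩ a≡1 b≡0)
  ±1 (inj₂ a≡-1) = inj₂ (cong₂ ⟨_,_⟩ a≡-1 b≡0)

cube-⊗ : ∀ ζ w → ζ ⊗ w ⊗ (ζ ⊗ w) ⊗ (ζ ⊗ w) ≡ ζ ⊗ ζ ⊗ ζ ⊗ (w ⊗ w ⊗ w)
cube-⊗ = RingSolver.solve-∀ ℤ[ω]-ring

-- Multiplying by a cube root of unity ω² or ω turns a residue ω or ω² = 1 + ω into 1.
cube-root-with-residue-1 : ∀ {w d} → Reduces w d → d ≢ 0₄ →
                           ∃ λ w′ → w′ ⊗ w′ ⊗ w′ ≡ w ⊗ w ⊗ w × Reduces w′ 1₄
cube-root-with-residue-1 {w} {true  , false} w↦1 _ = w , refl , w↦1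
cube-root-with-residue-1 {w} {false , true}  w↦ω _ =
  ω² ⊗ w , trans (cube-⊗ ω² w) (⊗-identityˡ (w ⊗ w ⊗ w)) ,
  reduces-⊗ {ω²} {w} {true , true} (odd -1ℤ refl , odd -1ℤ refl) w↦ω
cube-root-with-residue-1 {w} {true  , true}  w↦ω² _ =
  ω ⊗ w , trans (cube-⊗ ω w) (⊗-identityˡ (w ⊗ w ⊗ w)) ,
  reduces-⊗ {ω} {w} {false , true} (even 0ℤ refl , odd 0ℤ refl) w↦ω²
cube-root-with-residue-1 {w} {false , false} _ d≢0 = ⊥-elim (d≢0 refl)

cube-normal-form : ∀ {α k w} → Eisenstein.Unit k → α ≡ k ⊗ (w ⊗ w ⊗ w) → Reduces α 1₄ →
                   ∃ λ w′ → α ≡ w′ ⊗ w′ ⊗ w′ × Reduces w′ 1₄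
cube-normal-form {α} {k} {w} k-unit α≡kw³ α↦1 = absorb-sign (unit-reducing-to-1 {k} k-unit k↦1)
  where
  c = proj₁ (reduction k)
  d = proj₁ (reduction w)
  k↦c = proj₂ (reduction k)
  w↦d = proj₂ (reduction w)
  α↦kw³ : Reduces α (c · (d · d · d))
  α↦kw³ = subst (λ x → Reduces x (c · (d · d · d))) (sym α≡kw³)
            (reduces-⊗ {k} {w ⊗ w ⊗ w} k↦c (reduces-⊗ {w ⊗ w} {w} (reduces-⊗ {w} {w} w↦d w↦d) w↦d))
  c≡1,d≢0 = unit·cube≡1 c d (reduces-unique {α} α↦kw³ α↦1)
  k↦1 : Reduces k 1₄
  k↦1 = subst (Reduces k) (proj₁ c≡1,d≢0) k↦c
  from-cube-root : ∀ {v} → α ≡ v ⊗ v ⊗ v → Reduces v d → ∃ λ w′ → α ≡ w′ ⊗ w′ ⊗ w′ × Reduces w′ 1₄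
  from-cube-root {v} α≡v³ v↦d with cube-root-with-residue-1 {v} v↦d (proj₂ c≡1,d≢0)
  ... | w′ , w′³≡v³ , w′↦1 = w′ , trans α≡v³ (sym w′³≡v³) , w′↦1
  absorb-sign : k ≡ 1ω ⊎ k ≡ ⊖ 1ω → ∃ λ w′ → α ≡ w′ ⊗ w′ ⊗ w′ × Reduces w′ 1₄
  absorb-sign (inj₁ refl) = from-cube-root {w} (trans α≡kw³ (⊗-identityˡ (w ⊗ w ⊗ w))) w↦d
  absorb-sign (inj₂ refl) = from-cube-root {⊖ w} (trans α≡kw³ (neg-cube w)) (reduces-⊖ {w} w↦d)
    where
    neg-cube : ∀ w → ⊖ 1ω ⊗ (w ⊗ w ⊗ w) ≡ ⊖ w ⊗ ⊖ w ⊗ ⊖ w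
    neg-cube = RingSolver.solve-∀ ℤ[ω]-ring

coprime-to-norm : ∀ {m x} → Coprime m (norm x) → Eisenstein.Coprime x (ι m)
coprime-to-norm {m} {x} (s , t , sm+tN≡1) = ι t ⊗ conj x , ι s , (begin
  ι t ⊗ conj x ⊗ x ⊕ ι s ⊗ ι m    ≡⟨ lemma (ι t) (conj x) x (ι s ⊗ ι m) ⟩
  ι t ⊗ (x ⊗ conj x) ⊕ ι s ⊗ ι m  ≡⟨ cong (λ c → ι t ⊗ c ⊕ ι s ⊗ ι m) (⊗-conj x) ⟩
  ι t ⊗ ι (norm x) ⊕ ι s ⊗ ι m    ≡⟨ sym (cong₂ _⊕_ (ι-⊗ t (norm x)) (ι-⊗ s m)) ⟩
  ι (t * norm x + s * m)          ≡⟨ cong ι (trans (ℤ.+-comm (t * norm x) (s * m)) sm+tN≡1) ⟩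
  1ω                              ∎)
  where
  lemma : ∀ a b c d → a ⊗ b ⊗ c ⊕ d ≡ a ⊗ (c ⊗ b) ⊕ d
  lemma = RingSolver.solve-∀ ℤ[ω]-ring

-- a + a - b is the trace x + x̄ of x = ⟨ a , b ⟩.
coprime-to-conj : ∀ {a b} → Eisenstein.Coprime ⟨ a , b ⟩ (ι (a + a - b)) →
                  Eisenstein.Coprime ⟨ a , b ⟩ (conj ⟨ a , b ⟩)
coprime-to-conj {a} {b} coprime =
  subst (Eisenstein.Coprime ⟨ a , b ⟩) (cong₂ ⟨_,_⟩ (re-lemma a b) (im-lemma a b))
        (Eisenstein.coprime-+-multiple {⟨ a , b ⟩} {ι (a + a - b)} (⊖ 1ω) coprime)
  where
  re-lemma : ∀ a b → a + a - b + (- 1ℤ * a - - 0ℤ * b) ≡ a - b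
  re-lemma = solve-∀
  im-lemma : ∀ a b → 0ℤ + (- 1ℤ * b + - 0ℤ * a - - 0ℤ * b) ≡ - b
  im-lemma = solve-∀

-- (u + v√-3)³ = euler-p u v + euler-q u v · √-3
euler-p euler-q : ℤ → ℤ → ℤ
euler-p u v = u * u * u - + 9 * (u * (v * v))
euler-q u v = + 3 * (u * u * v) - + 3 * (v * v * v)

cube-components : ∀ u v → ⟨ u + v , v + v ⟩ ⊗ ⟨ u + v , v + v ⟩ ⊗ ⟨ u + v , v + v ⟩
                          ≡ ⟨ euler-p u v + euler-q u v , euler-q u v + euler-q u v ⟩
cube-components u v = cong₂ ⟨_,_⟩ (re-lemma u v) (im-lemma u v)
  where
  re-lemma : ∀ u v → ((u + v) * (u + v) - (v + v) * (v + v)) * (u + v)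
                     - ((u + v) * (v + v) + (v + v) * (u + v) - (v + v) * (v + v)) * (v + v)
                     ≡ (u * u * u - + 9 * (u * (v * v))) + (+ 3 * (u * u * v) - + 3 * (v * v * v))
  re-lemma = solve-∀
  im-lemma : ∀ u v → ((u + v) * (u + v) - (v + v) * (v + v)) * (v + v)
                     + ((u + v) * (v + v) + (v + v) * (u + v) - (v + v) * (v + v)) * (u + v)
                     - ((u + v) * (v + v) + (v + v) * (u + v) - (v + v) * (v + v)) * (v + v)
                     ≡ (+ 3 * (u * u * v) - + 3 * (v * v * v)) + (+ 3 * (u * u * v) - + 3 * (v * v * v))
  im-lemma = solve-∀

cube-with-residue-1 : ∀ {p q w} → ⟨ p + q , q + q ⟩ ≡ w ⊗ w ⊗ w → Reduces w 1₄ →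
                      ∃₂ λ u v → p ≡ euler-p u v × q ≡ euler-q u v
cube-with-residue-1 {p} {q} {⟨ c , _ ⟩} α≡w³ (_ , even v refl) = c - v , v , p≡A , q≡B
  where
  u = c - v
  A = euler-p u v
  B = euler-q u v
  α≡ : ⟨ p + q , q + q ⟩ ≡ ⟨ A + B , B + B ⟩
  α≡ = trans α≡w³ (trans (cong (λ c → ⟨ c , v + v ⟩ ⊗ ⟨ c , v + v ⟩ ⊗ ⟨ c , v + v ⟩) (lemma c v))
                         (cube-components u v))
    where
    lemma : ∀ c v → c ≡ c - v + v
    lemma = solve-∀
  q≡B : q ≡ B
  q≡B = double-injective (cong im α≡)
  p≡A : p ≡ A
  p≡A = begin
    p          ≡⟨ add-sub p q ⟩
    p + q - q  ≡⟨ cong₂ _-_ (cong re α≡) q≡B ⟩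
    A + B - B  ≡⟨ sym (add-sub A B) ⟩
    A          ∎
    where
    add-sub : ∀ x y → x ≡ x + y - y
    add-sub = solve-∀

-- α = p + q + 2qω = p + q√-3 is prime to 2p and to its conjugate, and α · 2pᾱ = θ³, so α is a
-- unit times a cube in ℤ[ω]; reducing modulo 2 shows that it is the cube of some u + v√-3.
euler-parametrisation : ∀ {p q θ} → Odd (p + q) → Coprime (p + p) (p * p + + 3 * (q * q)) →
  (p + p) * (p * p + + 3 * (q * q)) ≡ θ * θ * θ →
  ∃₂ λ u v → p ≡ euler-p u v × q ≡ euler-q u v
euler-parametrisation {p} {q} {θ} p+q-odd coprime equation =
  from-unit-cube (Eisenstein.coprime-product-unit-cube {α} {β} {ι θ} α≢0 α⊥β αβ≡θ³)
  where
  α β : ℤ[ω]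
  α = ⟨ p + q , q + q ⟩
  β = ι (p + p) ⊗ conj α
  N = p * p + + 3 * (q * q)
  norm-α : norm α ≡ N
  norm-α = lemma p q
    where
    lemma : ∀ p q → (p + q) * (p + q) - (p + q) * (q + q) + (q + q) * (q + q) ≡ p * p + + 3 * (q * q)
    lemma = solve-∀
  trace-α : p + q + (p + q) - (q + q) ≡ p + p
  trace-α = lemma p q
    where
    lemma : ∀ p q → p + q + (p + q) - (q + q) ≡ p + p
    lemma = solve-∀
  α≢0 : α ≢ 0ω
  α≢0 α≡0 = odd≢0 p+q-odd (cong re α≡0)
  α⊥2p : Eisenstein.Coprime α (ι (p + p))
  α⊥2p = coprime-to-norm {p + p} {α} (subst (Coprime (p + p)) (sym norm-α) coprime)
  α⊥β : Eisenstein.Coprime α β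
  α⊥β = Eisenstein.coprime-*ʳ {α} {ι (p + p)} {conj α} α⊥2p
          (coprime-to-conj {p + q} {q + q} (subst (λ t → Eisenstein.Coprime α (ι t)) (sym trace-α) α⊥2p))
  αβ≡θ³ : α ⊗ β ≡ ι θ ⊗ ι θ ⊗ ι θ
  αβ≡θ³ = begin
    α ⊗ (ι (p + p) ⊗ conj α)    ≡⟨ lemma α (ι (p + p)) (conj α) ⟩
    ι (p + p) ⊗ (α ⊗ conj α)    ≡⟨ cong (ι (p + p) ⊗_) (trans (⊗-conj α) (cong ι norm-α)) ⟩
    ι (p + p) ⊗ ι N             ≡⟨ sym (ι-⊗ (p + p) N) ⟩
    ι ((p + p) * N)             ≡⟨ cong ι equation ⟩
    ι (θ * θ * θ)               ≡⟨ trans (ι-⊗ (θ * θ) θ) (cong (_⊗ ι θ) (ι-⊗ θ θ)) ⟩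
    ι θ ⊗ ι θ ⊗ ι θ             ∎
    where
    lemma : ∀ a b c → a ⊗ (b ⊗ c) ≡ b ⊗ (a ⊗ c)
    lemma = RingSolver.solve-∀ ℤ[ω]-ring
  α↦1 : Reduces α 1₄
  α↦1 = p+q-odd , even q refl
  from-unit-cube : (∃₂ λ k w → Eisenstein.Unit k × α ≡ k ⊗ (w ⊗ w ⊗ w)) →
    ∃₂ λ u v → p ≡ euler-p u v × q ≡ euler-q u v
  from-unit-cube (k , w , k-unit , α≡kw³) with cube-normal-form {α} {k} {w} k-unit α≡kw³ α↦1
  ... | w′ , α≡w′³ , w′↦1 = cube-with-residue-1 {p} {q} {w′} α≡w′³ w′↦1

-- Euler's descent

record Solution (p q θ : ℤ) : Set where
  field
    p≢0      : p ≢ 0ℤ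
    q≢0      : q ≢ 0ℤ
    p+q-odd  : Odd (p + q)
    p⊥q      : Coprime p q
    equation : (p + p) * (p * p + + 3 * (q * q)) ≡ θ * θ * θ

-- If q were even, p and p² + 3q² would be odd, making the left side twice an odd number.
odd-q : ∀ {p q θ} → Odd (p + q) → (p + p) * (p * p + + 3 * (q * q)) ≡ θ * θ * θ → Odd q
odd-q {p} {q} {θ} p+q-odd equation with parity q
... | true  , q-odd  = q-odd
... | false , q-even = ⊥-elim (twice-odd≢cube {p * N} {θ} (parity-* p-odd N-odd) (trans (lemma p N) equation))
  where
  N = p * p + + 3 * (q * q)
  p-odd : Odd p
  p-odd = parity-+-cancelʳ p+q-odd q-even
  N-odd : Odd N
  N-odd = parity-+ (parity-* p-odd p-odd) (parity-* 3-odd (parity-* q-even q-even))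
  lemma : ∀ p N → p * N + p * N ≡ (p + p) * N
  lemma = solve-∀

coprime-2p-norm : ∀ {p q} → Even p → Odd q → Coprime (+ 3) p → Coprime p q →
                  Coprime (p + p) (p * p + + 3 * (q * q))
coprime-2p-norm {p} {q} p-even q-odd 3⊥p p⊥q = subst (λ x → Coprime x N) (2*x≡x+x p) (coprime-*ˡ {+ 2} {p} {N} 2⊥N p⊥N)
  where
  N = p * p + + 3 * (q * q)
  2⊥N : Coprime (+ 2) N
  2⊥N = odd⇒coprime-2 (parity-+ (parity-* p-even p-even) (parity-* 3-odd (parity-* q-odd q-odd)))
  p⊥N : Coprime p N
  p⊥N = subst (Coprime p) (ℤ.+-comm (+ 3 * (q * q)) (p * p))
          (coprime-+-multiple {p} {+ 3 * (q * q)} p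
             (coprime-*ʳ {p} {+ 3} {q * q} (coprime-sym {+ 3} {p} 3⊥p) (coprime-*ʳ {p} {q} {q} p⊥q p⊥q)))

euler-parities : ∀ {u v} → Odd (euler-q u v) → Even u × Odd v
euler-parities {u} {v} q-odd = from-parities (parity u) (parity v)
  where
  q-parity : ∀ {bu bv} → Parity u bu → Parity v bv →
             Parity (euler-q u v) ((true ∧ ((bu ∧ bu) ∧ bv)) xor (true ∧ bv))
  q-parity pu pv = parity-+ (parity-* 3-odd (parity-* (parity-* pu pu) pv)) (parity-neg (parity-* 3-odd (parity-cube pv)))
  from-parities : ∃ (Parity u) → ∃ (Parity v) → Even u × Odd v
  from-parities (false , pu) (true  , pv) = pu , pv
  from-parities (false , pu) (false , pv) with parity-unique q-odd (q-parity pu pv)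
  ... | ()
  from-parities (true  , pu) (false , pv) with parity-unique q-odd (q-parity pu pv)
  ... | ()
  from-parities (true  , pu) (true  , pv) with parity-unique q-odd (q-parity pu pv)
  ... | ()

factors-coprime : ∀ {u v} → Even u → Odd v → Coprime u v → Coprime (+ 3) u →
  Coprime (u + u) (u - + 3 * v) × Coprime (u + u) (u + + 3 * v) × Coprime (u - + 3 * v) (u + + 3 * v)
factors-coprime {u} {v} u-even v-odd u⊥v 3⊥u = 2u⊥X₂ , 2u⊥X₃ , X₂⊥X₃
  where
  X₂ = u - + 3 * v
  X₃ = u + + 3 * v
  X₂-odd : Odd X₂
  X₂-odd = parity-+ u-even (parity-neg (parity-* 3-odd v-odd))
  X₃-odd : Odd X₃
  X₃-odd = parity-+ u-even (parity-* 3-odd v-odd)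
  u⊥3v : Coprime u (+ 3 * v)
  u⊥3v = coprime-*ʳ (coprime-sym 3⊥u) u⊥v
  u⊥X₂ : Coprime u X₂
  u⊥X₂ = subst (Coprime u) (lemma u v) (coprime-+-multiple 1ℤ (coprime-neg u⊥3v))
    where
    lemma : ∀ u v → - (+ 3 * v) + 1ℤ * u ≡ u - + 3 * v
    lemma = solve-∀
  u⊥X₃ : Coprime u X₃
  u⊥X₃ = subst (Coprime u) (lemma u v) (coprime-+-multiple 1ℤ u⊥3v)
    where
    lemma : ∀ u v → + 3 * v + 1ℤ * u ≡ u + + 3 * v
    lemma = solve-∀
  2u⊥X₂ : Coprime (u + u) X₂
  2u⊥X₂ = subst (λ x → Coprime x X₂) (2*x≡x+x u) (coprime-*ˡ (odd⇒coprime-2 X₂-odd) u⊥X₂)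
  2u⊥X₃ : Coprime (u + u) X₃
  2u⊥X₃ = subst (λ x → Coprime x X₃) (2*x≡x+x u) (coprime-*ˡ (odd⇒coprime-2 X₃-odd) u⊥X₃)
  X₂⊥3 : Coprime X₂ (+ 3)
  X₂⊥3 = coprime-sym (subst (Coprime (+ 3)) (lemma u v) (coprime-+-multiple (- v) 3⊥u))
    where
    lemma : ∀ u v → u + - v * + 3 ≡ u - + 3 * v
    lemma = solve-∀
  X₂⊥v : Coprime X₂ v
  X₂⊥v = coprime-sym (subst (Coprime v) (lemma u v) (coprime-+-multiple (- + 3) (coprime-sym u⊥v)))
    where
    lemma : ∀ u v → u + - + 3 * v ≡ u - + 3 * v
    lemma = solve-∀
  X₂⊥X₃ : Coprime X₂ X₃
  X₂⊥X₃ = subst (Coprime X₂) (lemma u v)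
            (coprime-+-multiple 1ℤ (coprime-*ʳ (coprime-sym (odd⇒coprime-2 X₂-odd)) (coprime-*ʳ X₂⊥3 X₂⊥v)))
    where
    lemma : ∀ u v → + 2 * (+ 3 * v) + 1ℤ * (u - + 3 * v) ≡ u + + 3 * v
    lemma = solve-∀

sum-of-cubes : ∀ p q → (p + p) * (p * p + + 3 * (q * q)) ≡ (p - q) * (p - q) * (p - q) + (p + q) * (p + q) * (p + q)
sum-of-cubes = solve-∀

p∣θ³ : ∀ {p q θ} → Solution p q θ → p ∣′ θ * θ * θ
p∣θ³ {p} {q} {θ} S = (p * p + + 3 * (q * q)) + (p * p + + 3 * (q * q)) , trans (sym equation) (lemma p (p * p + + 3 * (q * q)))
  where
  open Solution S
  lemma : ∀ p n → (p + p) * n ≡ (n + n) * p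
  lemma = solve-∀

-- The solution has p - q = b and p + q = c.
solution-from-cubes : ∀ {a b c} → Odd b → Odd c → b ≢ c → Coprime b c → a ≢ 0ℤ →
                      b * b * b + c * c * c ≡ a * a * a → ∃₂ λ p q → Solution p q a
solution-from-cubes {a} {b} {c} (odd k refl) (odd l refl) b≢c b⊥c a≢0 b³+c³≡a³ = p , q , record
  { p≢0      = λ p≡0 → a≢0 (cube≡0⇒≡0 (trans (sym equation) (cong (λ p → (p + p) * (p * p + + 3 * (q * q))) p≡0)))
  ; q≢0      = λ q≡0 → b≢c (trans (sym p-q≡b)
                  (trans (cong (λ x → p - x) q≡0) (trans (sym (cong (λ x → p + x) q≡0)) p+q≡c)))
  ; p+q-odd  = subst Odd (sym p+q≡c) (odd l refl)
  ; p⊥q      = coprime-sum-difference (subst₂ Coprime (sym p-q≡b) (sym p+q≡c) b⊥c)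
  ; equation = equation
  }
  where
  p = k + l + 1ℤ
  q = l - k
  p-q≡b : p - q ≡ k + k + 1ℤ
  p-q≡b = lemma k l
    where
    lemma : ∀ k l → k + l + 1ℤ - (l - k) ≡ k + k + 1ℤ
    lemma = solve-∀
  p+q≡c : p + q ≡ l + l + 1ℤ
  p+q≡c = lemma k l
    where
    lemma : ∀ k l → k + l + 1ℤ + (l - k) ≡ l + l + 1ℤ
    lemma = solve-∀
  equation : (p + p) * (p * p + + 3 * (q * q)) ≡ a * a * a
  equation = begin
    (p + p) * (p * p + + 3 * (q * q))                         ≡⟨ sum-of-cubes p q ⟩
    (p - q) * (p - q) * (p - q) + (p + q) * (p + q) * (p + q) ≡⟨ cong₂ (λ x y → x * x * x + y * y * y) p-q≡b p+q≡c ⟩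
    (k + k + 1ℤ) * (k + k + 1ℤ) * (k + k + 1ℤ) + (l + l + 1ℤ) * (l + l + 1ℤ) * (l + l + 1ℤ) ≡⟨ b³+c³≡a³ ⟩
    a * a * a                                                 ∎

Descent : ℤ → Set
Descent θ = ∃ λ p → ∃₂ λ q θ′ → Solution p q θ′ × Coprime (+ 3) p × ∣ θ′ ∣ ℕ.< ∣ θ ∣

descent-from-cubes : ∀ {a b c θ m} → Odd b → Odd c → b ≢ c → Coprime b c → a ≢ 0ℤ → Coprime (+ 3) (a * a * a) →
  b * b * b + c * c * c ≡ a * a * a → 2 ℕ.≤ ∣ m ∣ → θ * θ * θ ≡ a * a * a * m → Descent θ
descent-from-cubes {a} {θ = θ} {m} b-odd c-odd b≢c b⊥c a≢0 3⊥a³ b³+c³≡a³ 2≤∣m∣ θ³≡a³m =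
  smaller (solution-from-cubes b-odd c-odd b≢c b⊥c a≢0 b³+c³≡a³)
  where
  smaller : (∃₂ λ p q → Solution p q a) → Descent θ
  smaller (p , q , S) =
    p , q , a , S , coprime-divisors ∣-refl (p∣θ³ S) 3⊥a³ , smaller-cube-root {a} {θ} {m} a≢0 2≤∣m∣ θ³≡a³m

-- 2u, u - 3v and u + 3v are pairwise coprime with product 2p = r³, hence cubes a³, b³, c³,
-- and b³ + c³ = 2u = a³.
descent-from-parametrisation : ∀ {p q θ} → Solution p q θ → Coprime (+ 3) p → Odd q →
  (∃ λ r → p + p ≡ r * r * r) → (∃₂ λ u v → p ≡ euler-p u v × q ≡ euler-q u v) → Descent θ
descent-from-parametrisation {θ = θ} S 3⊥p q-odd (r , 2p≡r³) (u , v , refl , refl) =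
  from-cubes (coprime-triple-product-cube {X₁} {X₂} {X₃} {r} X₁≢0 X₂≢0 X₃≢0 X₁⊥X₂ X₁⊥X₃ X₂⊥X₃
                (trans (sym 2p≡X₁X₂X₃) 2p≡r³))
  where
  open Solution S
  p = euler-p u v
  q = euler-q u v
  N = p * p + + 3 * (q * q)
  X₁ X₂ X₃ : ℤ
  X₁ = u + u
  X₂ = u - + 3 * v
  X₃ = u + + 3 * v
  u-even = proj₁ (euler-parities {u} {v} q-odd)
  v-odd  = proj₂ (euler-parities {u} {v} q-odd)
  X₂-odd : Odd X₂
  X₂-odd = parity-+ u-even (parity-neg (parity-* 3-odd v-odd))
  X₃-odd : Odd X₃
  X₃-odd = parity-+ u-even (parity-* 3-odd v-odd)
  u∣p : u ∣′ p
  u∣p = u * u - + 9 * (v * v) , lemma u v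
    where
    lemma : ∀ u v → u * u * u - + 9 * (u * (v * v)) ≡ (u * u - + 9 * (v * v)) * u
    lemma = solve-∀
  v∣q : v ∣′ q
  v∣q = + 3 * (u * u) - + 3 * (v * v) , lemma u v
    where
    lemma : ∀ u v → + 3 * (u * u * v) - + 3 * (v * v * v) ≡ (+ 3 * (u * u) - + 3 * (v * v)) * v
    lemma = solve-∀
  3⊥u : Coprime (+ 3) u
  3⊥u = coprime-divisors ∣-refl u∣p 3⊥p
  X₁⊥X₂,X₁⊥X₃,X₂⊥X₃ = factors-coprime u-even v-odd (coprime-divisors u∣p v∣q p⊥q) 3⊥u
  X₁⊥X₂ = proj₁ X₁⊥X₂,X₁⊥X₃,X₂⊥X₃
  X₁⊥X₃ = proj₁ (proj₂ X₁⊥X₂,X₁⊥X₃,X₂⊥X₃)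
  X₂⊥X₃ = proj₂ (proj₂ X₁⊥X₂,X₁⊥X₃,X₂⊥X₃)
  2p≡X₁X₂X₃ : p + p ≡ X₁ * (X₂ * X₃)
  2p≡X₁X₂X₃ = lemma u v
    where
    lemma : ∀ u v → u * u * u - + 9 * (u * (v * v)) + (u * u * u - + 9 * (u * (v * v)))
                    ≡ (u + u) * ((u - + 3 * v) * (u + + 3 * v))
    lemma = solve-∀
  X₁≢0 : X₁ ≢ 0ℤ
  X₁≢0 2u≡0 = p≢0 (trans (cong (λ u → euler-p u v) (double-injective {u} {0ℤ} 2u≡0)) (lemma v))
    where
    lemma : ∀ v → 0ℤ * 0ℤ * 0ℤ - + 9 * (0ℤ * (v * v)) ≡ 0ℤ
    lemma = solve-∀
  X₂≢0 = odd≢0 X₂-odd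
  X₃≢0 = odd≢0 X₃-odd
  m = X₂ * X₃ * N
  θ³≡X₁m : θ * θ * θ ≡ X₁ * m
  θ³≡X₁m = trans (sym equation) (trans (cong (_* N) 2p≡X₁X₂X₃) (ℤ.*-assoc X₁ (X₂ * X₃) N))
  2≤∣m∣ : 2 ℕ.≤ ∣ m ∣
  2≤∣m∣ = subst (2 ℕ.≤_) (sym (trans (ℤ.abs-* (X₂ * X₃) N) (cong (ℕ._* ∣ N ∣) (ℤ.abs-* X₂ X₃))))
            (ℕ.≤-trans (s≤s (s≤s z≤n))
                       (ℕ.*-mono-≤ (ℕ.*-mono-≤ (≢0⇒∣∣≥1 X₂≢0) (≢0⇒∣∣≥1 X₃≢0)) (∣x²+3y²∣≥3 p q≢0)))
  from-cubes : (∃ λ a → X₁ ≡ a * a * a) × (∃ λ b → X₂ ≡ b * b * b) × (∃ λ c → X₃ ≡ c * c * c) → Descent θ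
  from-cubes ((a , X₁≡a³) , (b , X₂≡b³) , (c , X₃≡c³)) =
    descent-from-cubes {a} {b} {c} {θ} {m} (odd-cube⇒odd (subst Odd X₂≡b³ X₂-odd)) (odd-cube⇒odd (subst Odd X₃≡c³ X₃-odd))
      b≢c b⊥c a≢0 3⊥a³ b³+c³≡a³ 2≤∣m∣ (trans θ³≡X₁m (cong (_* m) X₁≡a³))
    where
    b≢c : b ≢ c
    b≢c b≡c = u-3v≢u+3v {u} {v} v-odd (trans X₂≡b³ (trans (cong (λ x → x * x * x) b≡c) (sym X₃≡c³)))
    b⊥c : Coprime b c
    b⊥c = coprime-divisors (b * b , refl) (c * c , refl) (subst₂ Coprime X₂≡b³ X₃≡c³ X₂⊥X₃)
    a≢0 : a ≢ 0ℤ
    a≢0 a≡0 = X₁≢0 (trans X₁≡a³ (cong (λ x → x * x * x) a≡0))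
    3⊥a³ : Coprime (+ 3) (a * a * a)
    3⊥a³ = subst (Coprime (+ 3)) (trans (2*x≡x+x u) X₁≡a³) (coprime-*ʳ {+ 3} {+ 2} {u} (1ℤ , -1ℤ , refl) 3⊥u)
    b³+c³≡a³ : b * b * b + c * c * c ≡ a * a * a
    b³+c³≡a³ = trans (sym (cong₂ _+_ X₂≡b³ X₃≡c³)) (trans (lemma u v) X₁≡a³)
      where
      lemma : ∀ u v → u - + 3 * v + (u + + 3 * v) ≡ u + u
      lemma = solve-∀

descent-step : ∀ {p q θ} → Solution p q θ → Coprime (+ 3) p → Descent θ
descent-step {p} {q} {θ} S 3⊥p =
  descent-from-parametrisation {p} {q} {θ} S 3⊥p q-odd
    (coprime-product-cube {p + p} {p * p + + 3 * (q * q)} {θ} 2p≢0 2p⊥N equation)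
    (euler-parametrisation {p} {q} {θ} p+q-odd 2p⊥N equation)
  where
  open Solution S
  q-odd : Odd q
  q-odd = odd-q {p} {q} {θ} p+q-odd equation
  2p⊥N : Coprime (p + p) (p * p + + 3 * (q * q))
  2p⊥N = coprime-2p-norm (parity-+-cancelʳ p+q-odd q-odd) q-odd 3⊥p p⊥q
  2p≢0 : p + p ≢ 0ℤ
  2p≢0 2p≡0 = p≢0 (double-injective {p} {0ℤ} 2p≡0)

infinite-descent : ∀ {p q θ} → Acc ℕ._<_ ∣ θ ∣ → Solution p q θ → ¬ Coprime (+ 3) p
infinite-descent {p} {q} {θ} (acc rs) S 3⊥p = continue (descent-step S 3⊥p)
  where
  continue : Descent θ → ⊥
  continue (_ , _ , _ , S′ , 3⊥p′ , ∣θ′∣<∣θ∣) = infinite-descent (rs ∣θ′∣<∣θ∣) S′ 3⊥p′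

solution⇒3∣p : ∀ {p q θ} → Solution p q θ → + 3 ∣ p
solution⇒3∣p {p} {θ = θ} S with 3∣⊎coprime p
... | inj₁ 3∣p = 3∣p
... | inj₂ 3⊥p = ⊥-elim (infinite-descent (<-wellFounded ∣ θ ∣) S 3⊥p)

3∣p⇒3∣θ : ∀ {p q θ} → (p + p) * (p * p + + 3 * (q * q)) ≡ θ * θ * θ → + 3 ∣ p → + 3 ∣ θ
3∣p⇒3∣θ {p} {q} {θ} equation 3∣p with ∣⇒∣′ {+ 3} {p} 3∣p
... | k , refl = 3∣cube⇒3∣ {θ}
  (∣′⇒∣ {+ 3} {θ * θ * θ} ((k + k) * (k * + 3 * (k * + 3) + + 3 * (q * q)) , trans (sym equation) (lemma k q)))
  where
  lemma : ∀ k q → (k * + 3 + k * + 3) * (k * + 3 * (k * + 3) + + 3 * (q * q))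
                  ≡ (k + k) * (k * + 3 * (k * + 3) + + 3 * (q * q)) * + 3
  lemma = solve-∀

-- From p = 3k and θ = 3t the equation becomes 3t³ = 2k(3k² + q²), whose right side is prime to 3 unless 3 ∣ k.
3∣p⇒9∣p : ∀ {p q θ} → (p + p) * (p * p + + 3 * (q * q)) ≡ θ * θ * θ → + 3 ∣ p → ¬ (+ 3 ∣ q) → + 9 ∣ p
3∣p⇒9∣p {p} {q} {θ} equation 3∣p 3∤q
  with ∣⇒∣′ {+ 3} {p} 3∣p | ∣⇒∣′ {+ 3} {θ} (3∣p⇒3∣θ {p} {q} {θ} equation 3∣p)
... | k , refl | t , refl with 3∣⊎coprime k
...   | inj₁ 3∣k = 9∣3k (∣⇒∣′ {+ 3} {k} 3∣k)
  where
  9∣3k : + 3 ∣′ k → + 9 ∣ k * + 3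
  9∣3k (m , refl) = ∣′⇒∣ {+ 9} {m * + 3 * + 3} (m , lemma m)
    where
    lemma : ∀ m → m * + 3 * + 3 ≡ m * + 9
    lemma = solve-∀
...   | inj₂ 3⊥k = ⊥-elim (coprime⇒∤ {3} {Y} (s≤s (s≤s z≤n)) 3⊥Y (∣′⇒∣ {+ 3} {Y} (t * t * t , sym 3t³≡Y)))
  where
  Y = + 2 * k * (+ 3 * (k * k) + q * q)
  3t³≡Y : t * t * t * + 3 ≡ Y
  3t³≡Y = ℤ.*-cancelʳ-≡ (t * t * t * + 3) Y (+ 9) (trans (lemma₁ t) (trans (sym equation) (lemma₂ k q)))
    where
    lemma₁ : ∀ t → t * t * t * + 3 * + 9 ≡ t * + 3 * (t * + 3) * (t * + 3)
    lemma₁ = solve-∀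
    lemma₂ : ∀ k q → (k * + 3 + k * + 3) * (k * + 3 * (k * + 3) + + 3 * (q * q)) ≡ + 2 * k * (+ 3 * (k * k) + q * q) * + 9
    lemma₂ = solve-∀
  3⊥q : Coprime (+ 3) q
  3⊥q = ∤3⇒coprime 3∤q
  3⊥3k²+q² : Coprime (+ 3) (+ 3 * (k * k) + q * q)
  3⊥3k²+q² = subst (Coprime (+ 3)) (lemma k q) (coprime-+-multiple (k * k) (coprime-*ʳ 3⊥q 3⊥q))
    where
    lemma : ∀ k q → q * q + k * k * + 3 ≡ + 3 * (k * k) + q * q
    lemma = solve-∀
  3⊥Y : Coprime (+ 3) Y
  3⊥Y = coprime-*ʳ (coprime-*ʳ {+ 3} {+ 2} {k} (1ℤ , -1ℤ , refl) 3⊥k) 3⊥3k²+q²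

mainTheorem5 : (p q θ : ℤ) → p ≢ + 0 → q ≢ + 0 → ¬ (+ 2 ∣ (p + q)) → gcd p q ≡ + 1
    → θ ≢ + 0 → + 2 * p * (p ^ 2 + + 3 * q ^ 2) ≡ θ ^ 3
    → ((¬ (+ 2 ∣ q)) × (+ 9 ∣ p)) × ((+ 3 ∣ θ) × (¬ (+ 3 ∣ q)))
mainTheorem5 p q θ p≢0 q≢0 2∤p+q gcd≡1 _ E =
  (2∤q , 3∣p⇒9∣p {p} {q} {θ} equation 3∣p 3∤q) , (3∣p⇒3∣θ {p} {q} {θ} equation 3∣p , 3∤q)
  where
  -- x ^ n unfolds to x * (x * … * 1).
  equation : (p + p) * (p * p + + 3 * (q * q)) ≡ θ * θ * θ
  equation = trans (lhs p q) (trans E (rhs θ))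
    where
    lhs : ∀ p q → (p + p) * (p * p + + 3 * (q * q)) ≡ + 2 * p * (p * (p * + 1) + + 3 * (q * (q * + 1)))
    lhs = solve-∀
    rhs : ∀ θ → θ * (θ * (θ * + 1)) ≡ θ * θ * θ
    rhs = solve-∀
  S : Solution p q θ
  S = record
    { p≢0 = p≢0 ; q≢0 = q≢0 ; p+q-odd = ¬2∣⇒odd 2∤p+q ; p⊥q = gcd≡1⇒coprime gcd≡1 ; equation = equation }
  3∣p : + 3 ∣ p
  3∣p = solution⇒3∣p S
  2∤q : ¬ (+ 2 ∣ q)
  2∤q 2∣q with parity-unique (odd-q {p} {q} {θ} (Solution.p+q-odd S) equation) (2∣⇒even 2∣q)
  ... | ()
  3∤q : ¬ (+ 3 ∣ q)
  3∤q = coprime⇒¬common-divisor {3} {p} {q} (s≤s (s≤s z≤n)) (Solution.p⊥q S) 3∣p
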